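{- Let $p\ge 3$ be a prime, $n$ a positive integer, $G=\mathbb{Z}_{N_p}$ with $N_p=(n+1)p$, $\psi$ a complex linear character of $G$ of order $o(\psi)$, and $k\ge1$. Then (1) if $p\nmid o(\psi)$, $F_\psi(\overline{X}_{p,k})=(-1)^k\left[\frac{u^k}{k!}\right](1-u^{o(\psi)})^{\frac{(p-1)N_p}{p\,o(\psi)}}$; (2) if $p\mid o(\psi)$, $F_\psi(\overline{X}_{p,k})=(-1)^k\left[\frac{u^k}{k!}\right]\dfrac{(1-u^{o(\psi)})^{N_p/o(\psi)}}{(1-u^{o(\psi)/p})^{N_p/o(\psi)}}$.
   Context: $D_p\subset G$ is the set of residues modulo $N_p$ not divisible by $p$. $\overline{X}_{p,k}$ is the set of $k$-tuples in $D_p^k$ with pairwise distinct coordinates; $F_\psi(Y)=\sum_{(y_1,\ldots,y_k)\in Y}\prod_i\psi(y_i)$. $[u^k/k!]F(u)$ denotes $k!$ times the coefficient of $u^k$ in the power series $F(u)$. -}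

module Defs where

open import Level using (Level; _⊔_)
open import Algebra.Bundles using (CommutativeRing)
open import Data.Nat as ℕ using (ℕ; zero; suc; _≤_; _<_)
open import Data.Nat.Divisibility using (_∣_; _∣?_)
open import Data.Nat.DivMod using (_mod_)
open import Data.Integer as ℤ using (ℤ; +_; -[1+_])
open import Data.Fin as Fin using (Fin; toℕ; _≟_)
open import Data.Vec as Vec using (Vec; []; _∷_)
open import Data.Vec.Relation.Unary.All using (All; all?)
open import Data.Vec.Relation.Unary.AllPairs using (allPairs?)
open import Data.Vec.Relation.Unary.Unique.Propositional using (Unique)
open import Data.List as List using (List; [_]; concatMap; filter; allFin)
open import Data.Product using (_×_; Σ)
open import Data.Sum using (_⊎_)
open import Relation.Nullary using (¬_; ¬?)
open import Relation.Nullary.Decidable using (_×-dec_)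
open import Relation.Unary using (Decidable)
import Data.Nat.Properties as ℕP

private variable c ℓ : Level

-- The cyclic group G = ℤ_N, realised as Fin N with addition modulo N.

_⊕_ : ∀ {N} → Fin N → Fin N → Fin N
_⊕_ {suc m} a b = (toℕ a ℕ.+ toℕ b) mod suc m

Nₚ : ℕ → ℕ → ℕ
Nₚ p n = suc n ℕ.* p

InD : (p : ℕ) {N : ℕ} → Fin N → Set
InD p x = ¬ (p ∣ toℕ x)

InX : (p : ℕ) {N k : ℕ} → Vec (Fin N) k → Set
InX p v = All (InD p) v × Unique v

InX? : (p : ℕ) {N k : ℕ} → Decidable (InX p {N} {k})
InX? p v = all? (λ x → ¬? (p ∣? toℕ x)) v ×-dec allPairs? (λ x y → ¬? (x ≟ y)) v

allTuples : (N k : ℕ) → List (Vec (Fin N) k)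
allTuples N zero    = [ [] ]
allTuples N (suc k) = concatMap (λ x → List.map (x ∷_) (allTuples N k)) (allFin N)

Xbar : (p N k : ℕ) → List (Vec (Fin N) k)
Xbar p N k = filter (InX? p) (allTuples N k)

record IsIntegralDomain (R : CommutativeRing c ℓ) : Set (c ⊔ ℓ) where
  open CommutativeRing R
  field
    1≉0       : ¬ (1# ≈ 0#)
    noZeroDiv : ∀ x y → x * y ≈ 0# → (x ≈ 0#) ⊎ (y ≈ 0#)

module _ (R : CommutativeRing c ℓ) where
  open CommutativeRing R

  pow : Carrier → ℕ → Carrier
  pow x zero    = 1#
  pow x (suc m) = x * pow x m

  fromℕ : ℕ → Carrier
  fromℕ zero    = 0#
  fromℕ (suc m) = 1# + fromℕ m

  fromℤ : ℤ → Carrier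
  fromℤ (+ m)    = fromℕ m
  fromℤ -[1+ m ] = - fromℕ (suc m)

  record IsCharacter {N : ℕ} (ψ : Fin N → Carrier) : Set (c ⊔ ℓ) where
    field
      hom  : ∀ a b → ψ (a ⊕ b) ≈ ψ a * ψ b
      unit : ∀ a → Σ Carrier (λ y → ψ a * y ≈ 1#)

  PowTrivial : {N : ℕ} → (Fin N → Carrier) → ℕ → Set ℓ
  PowTrivial {N} ψ m = ∀ (x : Fin N) → pow (ψ x) m ≈ 1#

  HasOrder : {N : ℕ} → (Fin N → Carrier) → ℕ → Set ℓ
  HasOrder ψ o = (0 < o) × PowTrivial ψ o × (∀ m → 0 < m → PowTrivial ψ m → o ≤ m)

  prodψ : {N k : ℕ} → (Fin N → Carrier) → Vec (Fin N) k → Carrier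
  prodψ ψ []       = 1#
  prodψ ψ (y ∷ ys) = ψ y * prodψ ψ ys

  F : {N k : ℕ} → (Fin N → Carrier) → List (Vec (Fin N) k) → Carrier
  F ψ List.[]   = 0#
  F ψ (v List.∷ vs) = prodψ ψ v + F ψ vs

Series : Set
Series = ℕ → ℤ

mono : ℕ → Series
mono d j with d ℕ.≟ j
... | Relation.Nullary.yes _ = + 1
... | Relation.Nullary.no  _ = + 0

_⊖ₛ_ : Series → Series → Series
(f ⊖ₛ g) j = f j ℤ.- g j

conv : Series → Series → ℕ → ℕ → ℤ
conv f g j zero    = f 0 ℤ.* g j
conv f g j (suc i) = f (suc i) ℤ.* g (j ℕ.∸ suc i) ℤ.+ conv f g j i

_⊛_ : Series → Series → Series
(f ⊛ g) j = conv f g j j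

_^ₛ_ : Series → ℕ → Series
f ^ₛ zero  = mono 0
f ^ₛ suc m = f ⊛ (f ^ₛ m)

oneMinus : ℕ → Series
oneMinus d = mono 0 ⊖ₛ mono d

-- [u^k / k!] F = k! · (coefficient of u^k in F); with the sign (-1)^k
signedCoeff : ℕ → Series → ℤ
signedCoeff k f = (-[1+ 0 ] ℤ.^ k) ℤ.* (+ (k ℕ.!)) ℤ.* f k

-- F_ψ(X̄_{p,k}) sums ψ(y₁)⋯ψ(yₖ) over k-tuples of distinct elements of D_p, so it is
-- (-1)ᵏ k! times the coefficient of uᵏ in P(u) = ∏_{x ∈ D_p} (1 - ψ(x) u).  With ζ = ψ(1) we have ψ(x) = ζˣ,
-- and ζ is a primitive o-th root of unity, o = o(ψ).  In an integral domain ∏_{i<e} (1 - ηⁱ u) = 1 - uᵉ for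
-- every primitive e-th root of unity η: the product is invariant under u ↦ ηu, which kills the coefficients
-- of u¹, …, u^{e-1}, and it vanishes at u = 1.  So the product over all of ℤ_{N_p} is (1 - uᵒ)^{N_p/o}, and
-- the product over the multiples of p, whose ψ-values are the powers of η = ζᵖ, is (1 - uᵉ)^{(n+1)/e} with e
-- the order of η: e = o if p ∤ o, e = o/p if p ∣ o.  Hence (1 - uᵉ)^{(n+1)/e} P(u) = (1 - uᵒ)^{N_p/o}, and
-- cancelling the power of 1 - uᵉ gives both formulas.

{-# OPTIONS --safe #-}
module Submission where

open import Level using (Level; 0ℓ)
open import Algebra.Bundles using (CommutativeRing)
open import Algebra.Solver.Ring.AlmostCommutativeRing using (_-Raw-AlmostCommutative⟶_; fromCommutativeRing)
open import Data.Bool using (Bool; true; false; if_then_else_; _∧_; not)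
open import Data.Empty using (⊥-elim)
open import Data.Fin as Fin using (Fin; toℕ)
import Data.Fin.Properties as FinP
open import Data.Integer as ℤ using (ℤ; +_; -[1+_]; _⊖_)
import Data.Integer.Properties as ℤP
open import Data.List using (List; []; _∷_; _++_; [_]; _∷ʳ_; map; filter; length; upTo; applyUpTo; concatMap; tabulate; allFin)
import Data.List.Properties as ListP
open import Data.List.Membership.Propositional using (_∈_)
open import Data.List.Membership.Propositional.Properties using (∈-filter⁺; ∈-filter⁻; ∈-allFin)
import Data.List.Relation.Unary.All as ListAll
import Data.List.Relation.Unary.All.Properties as ListAllP
open import Data.List.Relation.Unary.AllPairs using (_∷_)
open import Data.List.Relation.Unary.Any using (here; there)
open import Data.List.Relation.Unary.Unique.Propositional using (Unique)
import Data.List.Relation.Unary.Unique.Propositional.Properties as Unique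
open import Data.Maybe using (Maybe; just; nothing)
open import Data.Nat as ℕ using (ℕ; zero; suc; _≤?_; _∸_; z≤n; s≤s; _≤_; _<_; _!)
open import Data.Nat.Coprimality using (Coprime; coprime-divisor)
open import Data.Nat.DivMod using (_%_; _/_)
import Data.Nat.DivMod as ℕDM
open import Data.Nat.Divisibility using (_∣_; divides; _∣?_)
import Data.Nat.Divisibility as ℕDiv
open import Data.Nat.Induction using (<-rec)
open import Data.Nat.Primality using (Prime; prime⇒irreducible)
import Data.Nat.Properties as ℕP
import Data.Nat.Solver as ℕSolver
open import Data.Product using (_×_; _,_; proj₁; proj₂)
open import Data.Sum using (inj₁; inj₂)
open import Data.Vec using (Vec) renaming (_∷_ to _∷ᵥ_)
import Data.Vec.Relation.Unary.All as VecAll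
import Data.Vec.Relation.Unary.AllPairs as AllPairs
open import Data.Vec.Relation.Unary.AllPairs using (allPairs?)
open import Data.Vec.Relation.Unary.Unique.Propositional using () renaming (Unique to VecUnique)
open import Function using (_∘_; id; case_of_)
open import Function.Bundles using (_⇔_; mk⇔; Equivalence)
open import Relation.Binary.Bundles using (Setoid)
open import Relation.Binary.Definitions using (tri<; tri≈; tri>)
import Relation.Binary.PropositionalEquality as ≡
open ≡ using (_≡_)
import Relation.Binary.Reasoning.Setoid
open import Relation.Nullary using (Dec; yes; no; does; ¬_)
open import Relation.Nullary.Decidable using (dec-true; dec-false; does-⇔; _×-dec_; ¬?)
open import Relation.Unary using (Pred; Decidable)
open import Relation.Unary.Properties using (∁?)

open import Defs

applyUpTo-+ : ∀ {A : Set} (f : ℕ → A) m n → applyUpTo f (m ℕ.+ n) ≡ applyUpTo f m ++ applyUpTo (f ∘ (m ℕ.+_)) n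
applyUpTo-+ f zero    n = ≡.refl
applyUpTo-+ f (suc m) n = ≡.cong (f 0 ∷_) (applyUpTo-+ (f ∘ suc) m n)

map-filter : ∀ {A B : Set} (f : A → B) {P : Pred B 0ℓ} (P? : Decidable P) xs → map f (filter (P? ∘ f) xs) ≡ filter P? (map f xs)
map-filter f P? []       = ≡.refl
map-filter f P? (x ∷ xs) with does (P? (f x))
... | true  = ≡.cong (f x ∷_) (map-filter f P? xs)
... | false = map-filter f P? xs

map-toℕ-allFin : ∀ n → map toℕ (allFin n) ≡ upTo n
map-toℕ-allFin n = ≡.trans (ListP.map-tabulate id toℕ) (tabulate-toℕ id n)
  where
    tabulate-toℕ : ∀ {A : Set} (f : ℕ → A) n → tabulate {n = n} (f ∘ toℕ) ≡ applyUpTo f n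
    tabulate-toℕ f zero    = ≡.refl
    tabulate-toℕ f (suc n) = ≡.cong (f 0 ∷_) (tabulate-toℕ (f ∘ suc) n)

filter-multiples : ∀ p′ m → filter (suc p′ ∣?_) (upTo (m ℕ.* suc p′)) ≡ map (ℕ._* suc p′) (upTo m)
filter-multiples p′ zero    = ≡.refl
filter-multiples p′ (suc m) = begin
  filter (p ∣?_) (upTo (p ℕ.+ m ℕ.* p))                          ≡⟨ ≡.cong (filter (p ∣?_) ∘ upTo) (ℕP.+-comm p (m ℕ.* p)) ⟩
  filter (p ∣?_) (upTo (m ℕ.* p ℕ.+ p))                          ≡⟨ ≡.cong (filter (p ∣?_)) (applyUpTo-+ id (m ℕ.* p) p) ⟩
  filter (p ∣?_) (upTo (m ℕ.* p) ++ applyUpTo (m ℕ.* p ℕ.+_) p)  ≡⟨ ListP.filter-++ (p ∣?_) (upTo (m ℕ.* p)) _ ⟩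
  filter (p ∣?_) (upTo (m ℕ.* p)) ++ filter (p ∣?_) (applyUpTo (m ℕ.* p ℕ.+_) p)
                                                                 ≡⟨ ≡.cong₂ _++_ (filter-multiples p′ m) last-block ⟩
  map (ℕ._* p) (upTo m) ++ [ m ℕ.* p ]                           ≡⟨ ListP.map-++ (ℕ._* p) (upTo m) [ m ] ⟨
  map (ℕ._* p) (upTo m ∷ʳ m)                                     ≡⟨ ≡.cong (map (ℕ._* p)) (ListP.upTo-∷ʳ m) ⟩
  map (ℕ._* p) (upTo (suc m))                                    ∎
  where
    open ≡.≡-Reasoning
    p : ℕ
    p = suc p′
    last-block : filter (p ∣?_) (applyUpTo (m ℕ.* p ℕ.+_) p) ≡ [ m ℕ.* p ]
    last-block = ≡.trans (ListP.filter-accept (p ∣?_) (≡.subst (p ∣_) (≡.sym (ℕP.+-identityʳ (m ℕ.* p))) (ℕDiv.n∣m*n m)))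
                   (≡.cong₂ _∷_ (ℕP.+-identityʳ (m ℕ.* p))
                     (ListP.filter-none (p ∣?_) (ListAllP.applyUpTo⁺₁ _ p′ λ i<p′ p∣ →
                       ℕP.<⇒≱ (s≤s i<p′) (ℕDiv.∣⇒≤ (ℕDiv.∣m+n∣m⇒∣n p∣ (ℕDiv.n∣m*n m))))))

¬∣⇒coprime : ∀ {p m} → Prime p → ¬ p ∣ m → Coprime m p
¬∣⇒coprime p-prime p∤m {d} (d∣m , d∣p) with prime⇒irreducible p-prime d∣p
... | inj₁ d≡1    = d≡1
... | inj₂ ≡.refl = ⊥-elim (p∤m d∣m)

∣-cancelʳ-coprime : ∀ {m p k} → Coprime m p → m ∣ k ℕ.* p → m ∣ k
∣-cancelʳ-coprime {m} {p} {k} m⊥p m∣kp = coprime-divisor m⊥p (≡.subst (m ∣_) (ℕP.*-comm k p) m∣kp)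

module IntegerImage {c ℓ} (R : CommutativeRing c ℓ) where
  open CommutativeRing R hiding (zero)
  open import Relation.Binary.Reasoning.Setoid setoid
  open import Algebra.Properties.Ring ring using (-0#≈0#; -‿distribˡ-*)
  open import Algebra.Properties.AbelianGroup +-abelianGroup using (⁻¹-∙-comm; ⁻¹-involutive)
  open import Algebra.Properties.Semiring.Mult semiring using () renaming (_×_ to _×ᵤ_)
  open import Algebra.Properties.Semiring.Mult.TCOptimised semiring using (1+×; ×ᵤ≈×; ×-homo-+; ×1-homo-*) renaming (_×_ to _×′_)

  -- fromℤ R, but with 1 ↦ 1# definitionally, so that it can serve as the coefficient map of the ring solver
  ιℕ : ℕ → Carrier
  ιℕ n = n ×′ 1#

  ι : ℤ → Carrier
  ι (+ n)    = ιℕ n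
  ι -[1+ n ] = - ιℕ (suc n)

  ιℕ-suc : ∀ n → ιℕ (suc n) ≈ 1# + ιℕ n
  ιℕ-suc n = 1+× n 1#

  ιℕ-* : ∀ m n → ιℕ (m ℕ.* n) ≈ ιℕ m * ιℕ n
  ιℕ-* = ×1-homo-*

  fromℤ≈ι : ∀ i → fromℤ R i ≈ ι i
  fromℤ≈ι (+ n)    = trans (fromℕ≈×ᵤ n) (×ᵤ≈× n 1#)
    where
      fromℕ≈×ᵤ : ∀ n → fromℕ R n ≈ n ×ᵤ 1#
      fromℕ≈×ᵤ zero    = refl
      fromℕ≈×ᵤ (suc n) = +-congˡ (fromℕ≈×ᵤ n)
  fromℤ≈ι -[1+ n ] = -‿cong (fromℤ≈ι (+ suc n))

  ι-⊖ : ∀ m n → ι (m ⊖ n) ≈ ιℕ m - ιℕ n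
  ι-⊖ m       zero    = sym (trans (+-congˡ -0#≈0#) (+-identityʳ _))
  ι-⊖ zero    (suc n) = sym (+-identityˡ _)
  ι-⊖ (suc m) (suc n) = begin
    ι (suc m ⊖ suc n)        ≡⟨ ≡.cong ι (ℤP.[1+m]⊖[1+n]≡m⊖n m n) ⟩
    ι (m ⊖ n)                ≈⟨ ι-⊖ m n ⟩
    a - b                    ≈⟨ +-identityˡ _ ⟨
    0# + (a - b)             ≈⟨ +-congʳ (-‿inverseʳ 1#) ⟨
    (1# - 1#) + (a - b)      ≈⟨ +-assoc _ _ _ ⟩
    1# + (- 1# + (a - b))    ≈⟨ +-congˡ (+-assoc _ _ _) ⟨
    1# + ((- 1# + a) - b)    ≈⟨ +-congˡ (+-congʳ (+-comm _ _)) ⟩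
    1# + ((a - 1#) - b)      ≈⟨ +-congˡ (+-assoc _ _ _) ⟩
    1# + (a + (- 1# - b))    ≈⟨ +-assoc _ _ _ ⟨
    (1# + a) + (- 1# - b)    ≈⟨ +-congˡ (⁻¹-∙-comm _ _) ⟩
    (1# + a) - (1# + b)      ≈⟨ +-cong (ιℕ-suc m) (-‿cong (ιℕ-suc n)) ⟨
    ιℕ (suc m) - ιℕ (suc n)  ∎
    where
      a b : Carrier
      a = ιℕ m
      b = ιℕ n

  ι-neg : ∀ i → ι (ℤ.- i) ≈ - ι i
  ι-neg (+ zero)  = sym -0#≈0#
  ι-neg (+ suc n) = refl
  ι-neg -[1+ n ]  = sym (⁻¹-involutive _)

  ι-+ : ∀ i j → ι (i ℤ.+ j) ≈ ι i + ι j
  ι-+ (+ m)    (+ n)    = ×-homo-+ 1# m n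
  ι-+ (+ m)    -[1+ n ] = ι-⊖ m (suc n)
  ι-+ -[1+ m ] (+ n)    = trans (ι-⊖ n (suc m)) (+-comm _ _)
  ι-+ -[1+ m ] -[1+ n ] = begin
    - ιℕ (suc (suc (m ℕ.+ n)))   ≡⟨ ≡.cong (λ t → - ιℕ (suc t)) (≡.sym (ℕP.+-suc m n)) ⟩
    - ιℕ (suc m ℕ.+ suc n)       ≈⟨ -‿cong (×-homo-+ 1# (suc m) (suc n)) ⟩
    - (ιℕ (suc m) + ιℕ (suc n))  ≈⟨ ⁻¹-∙-comm _ _ ⟨
    - ιℕ (suc m) + - ιℕ (suc n)  ∎

  ι-*⁺ : ∀ m j → ι (+ m ℤ.* j) ≈ ιℕ m * ι j
  ι-*⁺ zero    j = sym (zeroˡ _)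
  ι-*⁺ (suc m) j = begin
    ι (+ suc m ℤ.* j)              ≡⟨ ≡.cong ι (ℤP.*-distribʳ-+ j (+ 1) (+ m)) ⟩
    ι (+ 1 ℤ.* j ℤ.+ + m ℤ.* j)    ≈⟨ ι-+ (+ 1 ℤ.* j) (+ m ℤ.* j) ⟩
    ι (+ 1 ℤ.* j) + ι (+ m ℤ.* j)  ≈⟨ +-cong (reflexive (≡.cong ι (ℤP.*-identityˡ j))) (ι-*⁺ m j) ⟩
    ι j + ιℕ m * ι j               ≈⟨ +-congʳ (*-identityˡ _) ⟨
    1# * ι j + ιℕ m * ι j          ≈⟨ distribʳ _ _ _ ⟨
    (1# + ιℕ m) * ι j              ≈⟨ *-congʳ (ιℕ-suc m) ⟨
    ιℕ (suc m) * ι j               ∎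

  ι-* : ∀ i j → ι (i ℤ.* j) ≈ ι i * ι j
  ι-* (+ m)    j = ι-*⁺ m j
  ι-* -[1+ m ] j = begin
    ι (-[1+ m ] ℤ.* j)       ≡⟨ ≡.cong ι (≡.sym (ℤP.neg-distribˡ-* (+ suc m) j)) ⟩
    ι (ℤ.- (+ suc m ℤ.* j))  ≈⟨ ι-neg (+ suc m ℤ.* j) ⟩
    - ι (+ suc m ℤ.* j)      ≈⟨ -‿cong (ι-*⁺ (suc m) j) ⟩
    - (ιℕ (suc m) * ι j)     ≈⟨ -‿distribˡ-* _ _ ⟩
    - ιℕ (suc m) * ι j       ∎

  ι-homomorphism : ℤ.+-*-rawRing -Raw-AlmostCommutative⟶ fromCommutativeRing R
  ι-homomorphism = record
    { ⟦_⟧ = ι ; +-homo = ι-+ ; *-homo = ι-* ; -‿homo = ι-neg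
    ; 0-homo = refl ; 1-homo = refl }

  ι-≟ : ∀ i j → Maybe (ι i ≈ ι j)
  ι-≟ i j with i ℤ.≟ j
  ... | yes ≡.refl = just refl
  ... | no _       = nothing

  open import Algebra.Solver.Ring ℤ.+-*-rawRing (fromCommutativeRing R) ι-homomorphism ι-≟ public


module Powers {c ℓ} (R : CommutativeRing c ℓ) where
  open CommutativeRing R hiding (zero)
  open import Relation.Binary.Reasoning.Setoid setoid

  infixr 8 _^_
  _^_ : Carrier → ℕ → Carrier
  _^_ = pow R

  ^-cong : ∀ {x y} m → x ≈ y → x ^ m ≈ y ^ m
  ^-cong zero    _   = refl
  ^-cong (suc m) x≈y = *-cong x≈y (^-cong m x≈y)

  ^-+ : ∀ x m n → x ^ (m ℕ.+ n) ≈ x ^ m * x ^ n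
  ^-+ x zero    n = sym (*-identityˡ _)
  ^-+ x (suc m) n = trans (*-congˡ (^-+ x m n)) (sym (*-assoc _ _ _))

  ^-* : ∀ x m n → x ^ (m ℕ.* n) ≈ (x ^ n) ^ m
  ^-* x zero    n = refl
  ^-* x (suc m) n = trans (^-+ x n (m ℕ.* n)) (*-congˡ (^-* x m n))

  1^ : ∀ m → 1# ^ m ≈ 1#
  1^ zero    = refl
  1^ (suc m) = trans (*-identityˡ _) (1^ m)

  ^-periodic : ∀ {x o} → x ^ o ≈ 1# → ∀ m → x ^ (o ℕ.+ m) ≈ x ^ m
  ^-periodic {x} {o} xᵒ≈1 m = trans (^-+ x o m) (trans (*-congʳ xᵒ≈1) (*-identityˡ _))

  IsPrimitiveRootOfUnity : Carrier → ℕ → Set ℓ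
  IsPrimitiveRootOfUnity η o = η ^ o ≈ 1# × (∀ m → 0 < m → m < o → ¬ η ^ m ≈ 1#)

  primitive-∣ : ∀ {η o′} → IsPrimitiveRootOfUnity η (suc o′) → ∀ m → η ^ m ≈ 1# → suc o′ ∣ m
  primitive-∣ {η} {o′} (ηᵒ≈1 , minimal) m ηᵐ≈1 with m % suc o′ in r≡ | ℕDM.m≡m%n+[m/n]*n m (suc o′)
  ... | zero  | m≡q*o = divides (m / suc o′) m≡q*o
  ... | suc r | m≡r+q*o = ⊥-elim (minimal (suc r) (s≤s z≤n) (≡.subst (_< suc o′) r≡ (ℕDM.m%n<n m (suc o′))) (begin
    η ^ suc r                       ≈⟨ *-identityʳ _ ⟨
    η ^ suc r * 1#                  ≈⟨ *-congˡ (trans (^-* η q (suc o′)) (trans (^-cong q ηᵒ≈1) (1^ q))) ⟨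
    η ^ suc r * η ^ (q ℕ.* suc o′)  ≈⟨ ^-+ η (suc r) (q ℕ.* suc o′) ⟨
    η ^ (suc r ℕ.+ q ℕ.* suc o′)    ≡⟨ ≡.cong (η ^_) m≡r+q*o ⟨
    η ^ m                           ≈⟨ ηᵐ≈1 ⟩
    1#                              ∎))
    where
      q : ℕ
      q = m / suc o′

-- Power series over R as coefficient sequences.  Only multiplication by 1 - a u, by 1 - uᵈ and by finite
-- products of such factors is ever needed, so no general product of series is defined.
module PowerSeries {c ℓ} (R : CommutativeRing c ℓ) where
  open CommutativeRing R hiding (zero)
  private module ≈-Reasoning = Relation.Binary.Reasoning.Setoid setoid
  open Powers R public
  open IntegerImage R using (solve; _:+_; _:*_; :-_; _:-_; _:=_; con)

  Seq : Set c
  Seq = ℕ → Carrier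

  infix 4 _≋_
  _≋_ : Seq → Seq → Set ℓ
  f ≋ g = ∀ k → f k ≈ g k

  ≋-setoid : Setoid c ℓ
  ≋-setoid = record
    { Carrier = Seq ; _≈_ = _≋_
    ; isEquivalence = record
      { refl = λ _ → refl ; sym = λ e k → sym (e k) ; trans = λ e e′ k → trans (e k) (e′ k) } }

  open Setoid ≋-setoid public using () renaming (refl to ≋-refl; sym to ≋-sym; trans to ≋-trans; reflexive to ≋-reflexive)
  module ≋-Reasoning = Relation.Binary.Reasoning.Setoid ≋-setoid

  1ₛ : Seq
  1ₛ zero    = 1#
  1ₛ (suc k) = 0#

  shift : ℕ → Seq → Seq
  shift d g k with d ≤? k
  ... | yes _ = g (k ∸ d)
  ... | no  _ = 0#

  infixr 6 [1-u^_]·_ [1-u^_]^_·_ [1-_u]·_ ∏[1-_u]_·_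

  [1-u^_]·_ : ℕ → Seq → Seq
  ([1-u^ d ]· g) k = g k - shift d g k

  [1-u^_]^_·_ : ℕ → ℕ → Seq → Seq
  [1-u^ d ]^ zero  · g = g
  [1-u^ d ]^ suc M · g = [1-u^ d ]· [1-u^ d ]^ M · g

  [1-_u]·_ : Carrier → Seq → Seq
  ([1- a u]· g) zero    = g zero
  ([1- a u]· g) (suc k) = g (suc k) - a * g k

  ∏[1-_u]_·_ : {A : Set} → (A → Carrier) → List A → Seq → Seq
  ∏[1- f u] []       · g = g
  ∏[1- f u] (x ∷ xs) · g = [1- f x u]· ∏[1- f u] xs · g

  shift-≥ : ∀ {d k} g → d ≤ k → shift d g k ≡ g (k ∸ d)
  shift-≥ {d} {k} g d≤k with d ≤? k
  ... | yes _   = ≡.refl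
  ... | no  d≰k = ⊥-elim (d≰k d≤k)

  shift-< : ∀ {d k} g → k < d → shift d g k ≡ 0#
  shift-< {d} {k} g k<d with d ≤? k
  ... | yes d≤k = ⊥-elim (ℕP.<⇒≱ k<d d≤k)
  ... | no  _   = ≡.refl

  shift-cong : ∀ d {f g} → f ≋ g → shift d f ≋ shift d g
  shift-cong d f≋g k with d ≤? k
  ... | yes _ = f≋g (k ∸ d)
  ... | no  _ = refl

  [1-u^]·-cong : ∀ d {f g} → f ≋ g → [1-u^ d ]· f ≋ [1-u^ d ]· g
  [1-u^]·-cong d f≋g k = +-cong (f≋g k) (-‿cong (shift-cong d f≋g k))

  [1-u^]^-cong : ∀ d M {f g} → f ≋ g → [1-u^ d ]^ M · f ≋ [1-u^ d ]^ M · g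
  [1-u^]^-cong d zero    f≋g = f≋g
  [1-u^]^-cong d (suc M) f≋g = [1-u^]·-cong d ([1-u^]^-cong d M f≋g)

  [1-u^]^-+ : ∀ d a b g → [1-u^ d ]^ (a ℕ.+ b) · g ≋ [1-u^ d ]^ a · [1-u^ d ]^ b · g
  [1-u^]^-+ d zero    b g = ≋-refl
  [1-u^]^-+ d (suc a) b g = [1-u^]·-cong d ([1-u^]^-+ d a b g)

  [1-u^]^-suc : ∀ d M g → [1-u^ d ]^ M · [1-u^ d ]· g ≋ [1-u^ d ]^ suc M · g
  [1-u^]^-suc d zero    g = ≋-refl
  [1-u^]^-suc d (suc M) g = [1-u^]·-cong d ([1-u^]^-suc d M g)

  [1-u]·-cong : ∀ {a b f g} → a ≈ b → f ≋ g → [1- a u]· f ≋ [1- b u]· g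
  [1-u]·-cong a≈b f≋g zero    = f≋g zero
  [1-u]·-cong a≈b f≋g (suc k) = +-cong (f≋g (suc k)) (-‿cong (*-cong a≈b (f≋g k)))

  ∏-cong : ∀ {A : Set} {f f′ : A → Carrier} xs {g g′} → (∀ x → f x ≈ f′ x) → g ≋ g′ →
           ∏[1- f u] xs · g ≋ ∏[1- f′ u] xs · g′
  ∏-cong []       f≈f′ g≋g′ = g≋g′
  ∏-cong (x ∷ xs) f≈f′ g≋g′ = [1-u]·-cong (f≈f′ x) (∏-cong xs f≈f′ g≋g′)

  ∏-++ : ∀ {A : Set} (f : A → Carrier) xs ys g → ∏[1- f u] (xs ++ ys) · g ≡ ∏[1- f u] xs · ∏[1- f u] ys · g
  ∏-++ f []       ys g = ≡.refl
  ∏-++ f (x ∷ xs) ys g = ≡.cong ([1- f x u]·_) (∏-++ f xs ys g)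

  ∏-map : ∀ {A B : Set} (f : B → Carrier) (h : A → B) xs g → ∏[1- f u] map h xs · g ≡ ∏[1- f ∘ h u] xs · g
  ∏-map f h []       g = ≡.refl
  ∏-map f h (x ∷ xs) g = ≡.cong ([1- f (h x) u]·_) (∏-map f h xs g)

  ∏-upTo-+ : ∀ (f : ℕ → Carrier) m n g → ∏[1- f u] upTo (m ℕ.+ n) · g ≡ ∏[1- f u] upTo m · ∏[1- f ∘ (m ℕ.+_) u] upTo n · g
  ∏-upTo-+ f m n g = begin
    ∏[1- f u] upTo (m ℕ.+ n) · g
      ≡⟨ ≡.cong (λ xs → ∏[1- f u] xs · g) (applyUpTo-+ id m n) ⟩
    ∏[1- f u] (upTo m ++ applyUpTo (m ℕ.+_) n) · g
      ≡⟨ ∏-++ f (upTo m) (applyUpTo (m ℕ.+_) n) g ⟩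
    ∏[1- f u] upTo m · ∏[1- f u] applyUpTo (m ℕ.+_) n · g
      ≡⟨ ≡.cong (λ xs → ∏[1- f u] upTo m · ∏[1- f u] xs · g) (ListP.map-upTo (m ℕ.+_) n) ⟨
    ∏[1- f u] upTo m · ∏[1- f u] map (m ℕ.+_) (upTo n) · g
      ≡⟨ ≡.cong (∏[1- f u] upTo m ·_) (∏-map f (m ℕ.+_) (upTo n) g) ⟩
    ∏[1- f u] upTo m · ∏[1- f ∘ (m ℕ.+_) u] upTo n · g
      ∎
    where open ≡.≡-Reasoning

  [1-u]·-comm : ∀ a b g → [1- a u]· [1- b u]· g ≋ [1- b u]· [1- a u]· g
  [1-u]·-comm a b g zero          = refl
  [1-u]·-comm a b g (suc zero)    =
    solve 4 (λ a b g₀ g₁ → (g₁ :- b :* g₀) :- a :* g₀ := (g₁ :- a :* g₀) :- b :* g₀) refl a b (g 0) (g 1)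
  [1-u]·-comm a b g (suc (suc k)) =
    solve 5 (λ a b g₀ g₁ g₂ → (g₂ :- b :* g₁) :- a :* (g₁ :- b :* g₀) := (g₂ :- a :* g₁) :- b :* (g₁ :- a :* g₀))
      refl a b (g k) (g (suc k)) (g (suc (suc k)))

  [1-u]·-[1-u^]·-comm : ∀ a d g → [1- a u]· [1-u^ d ]· g ≋ [1-u^ d ]· [1- a u]· g
  [1-u]·-[1-u^]·-comm a d g zero with d ≤? 0
  ... | yes z≤n = refl
  ... | no  _ = refl
  [1-u]·-[1-u^]·-comm a d g (suc k) with d ≤? suc k | d ≤? k
  ... | no d≰1+k | yes d≤k = ⊥-elim (d≰1+k (ℕP.m≤n⇒m≤1+n d≤k))
  ... | no _     | no _    = solve 3 (λ x y a → (x :- con (+ 0)) :- a :* (y :- con (+ 0)) := (x :- a :* y) :- con (+ 0)) refl (g (suc k)) (g k) a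
  ... | yes _    | no d≰k  rewrite ℕP.m≤n⇒m∸n≡0 (ℕP.≰⇒> d≰k) =
    solve 4 (λ x y g₀ a → (x :- g₀) :- a :* (y :- con (+ 0)) := (x :- a :* y) :- g₀) refl (g (suc k)) (g k) (g 0) a
  ... | yes _    | yes d≤k rewrite ℕP.+-∸-assoc 1 d≤k =
    solve 5 (λ x y u v a → (x :- u) :- a :* (y :- v) := (x :- a :* y) :- (u :- a :* v)) refl (g (suc k)) (g k) (g (suc (k ∸ d))) (g (k ∸ d)) a

  [1-u]·-[1-u^]^-comm : ∀ a d M g → [1- a u]· [1-u^ d ]^ M · g ≋ [1-u^ d ]^ M · [1- a u]· g
  [1-u]·-[1-u^]^-comm a d zero    g = ≋-refl
  [1-u]·-[1-u^]^-comm a d (suc M) g =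
    ≋-trans ([1-u]·-[1-u^]·-comm a d _) ([1-u^]·-cong d ([1-u]·-[1-u^]^-comm a d M g))

  ∏-[1-u]·-comm : ∀ {A : Set} (f : A → Carrier) xs a g → ∏[1- f u] xs · [1- a u]· g ≋ [1- a u]· ∏[1- f u] xs · g
  ∏-[1-u]·-comm f []       a g = ≋-refl
  ∏-[1-u]·-comm f (x ∷ xs) a g = ≋-trans ([1-u]·-cong refl (∏-[1-u]·-comm f xs a g)) ([1-u]·-comm _ _ _)

  ∏-comm : ∀ {A B : Set} (f : A → Carrier) xs (f′ : B → Carrier) ys g →
           ∏[1- f u] xs · ∏[1- f′ u] ys · g ≋ ∏[1- f′ u] ys · ∏[1- f u] xs · g
  ∏-comm f xs f′ []       g = ≋-refl
  ∏-comm f xs f′ (y ∷ ys) g = ≋-trans (∏-[1-u]·-comm f xs (f′ y) _) ([1-u]·-cong refl (∏-comm f xs f′ ys g))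

  ∏-[1-u^]^-comm : ∀ {A : Set} (f : A → Carrier) xs d M g → ∏[1- f u] xs · [1-u^ d ]^ M · g ≋ [1-u^ d ]^ M · ∏[1- f u] xs · g
  ∏-[1-u^]^-comm f []       d M g = ≋-refl
  ∏-[1-u^]^-comm f (x ∷ xs) d M g =
    ≋-trans ([1-u]·-cong refl (∏-[1-u^]^-comm f xs d M g)) ([1-u]·-[1-u^]^-comm _ d M _)

  ∏-partition : ∀ {A : Set} {P : Pred A 0ℓ} (P? : Decidable P) (f : A → Carrier) xs g →
                ∏[1- f u] xs · g ≋ ∏[1- f u] filter P? xs · ∏[1- f u] filter (∁? P?) xs · g
  ∏-partition P? f []       g = ≋-refl
  ∏-partition P? f (x ∷ xs) g with P? x
  ... | yes _ = [1-u]·-cong refl (∏-partition P? f xs g)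
  ... | no  _ = ≋-trans ([1-u]·-cong refl (∏-partition P? f xs g)) (≋-sym (∏-[1-u]·-comm f (filter P? xs) (f x) _))

  [1-u^]·-injective : ∀ d → 0 < d → ∀ {f g} → [1-u^ d ]· f ≋ [1-u^ d ]· g → f ≋ g
  [1-u^]·-injective d 0<d {f} {g} eq = <-rec (λ k → f k ≈ g k) step
    where
      open ≈-Reasoning
      shift-agrees : ∀ k → (∀ {j} → j < k → f j ≈ g j) → shift d f k ≈ shift d g k
      shift-agrees k ih with d ≤? k
      ... | yes d≤k = ih (ℕP.∸-monoʳ-< 0<d d≤k)
      ... | no  _   = refl
      step : ∀ k → (∀ {j} → j < k → f j ≈ g j) → f k ≈ g k
      step k ih = begin
        f k                                ≈⟨ solve 2 (λ x y → x := (x :- y) :+ y) refl (f k) (shift d f k) ⟩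
        (f k - shift d f k) + shift d f k  ≈⟨ +-cong (eq k) (shift-agrees k ih) ⟩
        (g k - shift d g k) + shift d g k  ≈⟨ solve 2 (λ x y → (x :- y) :+ y := x) refl (g k) (shift d g k) ⟩
        g k                                ∎

  [1-u^]^-injective : ∀ d → 0 < d → ∀ M {f g} → [1-u^ d ]^ M · f ≋ [1-u^ d ]^ M · g → f ≋ g
  [1-u^]^-injective d 0<d zero    eq = eq
  [1-u^]^-injective d 0<d (suc M) eq = [1-u^]^-injective d 0<d M ([1-u^]·-injective d 0<d eq)

  ∏-constantTerm : ∀ {A : Set} (f : A → Carrier) xs g → (∏[1- f u] xs · g) 0 ≡ g 0
  ∏-constantTerm f []       g = ≡.refl
  ∏-constantTerm f (x ∷ xs) g = ∏-constantTerm f xs g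

  scale : Carrier → Seq → Seq
  scale η g k = η ^ k * g k

  scale-1ₛ : ∀ η → scale η 1ₛ ≋ 1ₛ
  scale-1ₛ η zero    = *-identityˡ _
  scale-1ₛ η (suc k) = zeroʳ _

  scale-∏ : ∀ {A : Set} η (f : A → Carrier) xs g → scale η (∏[1- f u] xs · g) ≋ ∏[1- (λ x → f x * η) u] xs · scale η g
  scale-∏ η f []       g = ≋-refl
  scale-∏ η f (x ∷ xs) g = ≋-trans (scale-[1-u]· (f x) _) ([1-u]·-cong refl (scale-∏ η f xs g))
    where
      scale-[1-u]· : ∀ a h → scale η ([1- a u]· h) ≋ [1- a * η u]· scale η h
      scale-[1-u]· a h zero    = refl
      scale-[1-u]· a h (suc k) =
        solve 5 (λ η e a x y → (η :* e) :* (x :- a :* y) := η :* e :* x :- (a :* η) :* (e :* y))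
          refl η (η ^ k) a (h (suc k)) (h k)

  DegreeBelow : ℕ → Seq → Set ℓ
  DegreeBelow B g = ∀ k → B ≤ k → g k ≈ 0#

  ∏-degree : ∀ {A : Set} (f : A → Carrier) xs {B g} → DegreeBelow B g → DegreeBelow (length xs ℕ.+ B) (∏[1- f u] xs · g)
  ∏-degree f []       g<B = g<B
  ∏-degree f (x ∷ xs) g<B (suc k) (s≤s B≤k) = begin
    h (suc k) - f x * h k  ≈⟨ +-cong (∏-degree f xs g<B (suc k) (ℕP.m≤n⇒m≤1+n B≤k)) (-‿cong (*-congˡ (∏-degree f xs g<B k B≤k))) ⟩
    0# - f x * 0#          ≈⟨ solve 1 (λ a → con (+ 0) :- a :* con (+ 0) := con (+ 0)) refl (f x) ⟩
    0#                     ∎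
    where
      open ≈-Reasoning
      h : Seq
      h = ∏[1- f u] xs · _

  1ₛ-degree : DegreeBelow 1 1ₛ
  1ₛ-degree (suc k) _ = refl

  partialSum : Seq → ℕ → Carrier
  partialSum g zero    = 0#
  partialSum g (suc B) = partialSum g B + g B

  partialSum-[1-u]· : ∀ h B → partialSum ([1- 1# u]· h) (suc B) ≈ h B
  partialSum-[1-u]· h zero    = +-identityˡ _
  partialSum-[1-u]· h (suc B) = begin
    partialSum ([1- 1# u]· h) (suc B) + (h (suc B) - 1# * h B)  ≈⟨ +-congʳ (partialSum-[1-u]· h B) ⟩
    h B + (h (suc B) - 1# * h B)                                ≈⟨ solve 2 (λ x y → x :+ (y :- con (+ 1) :* x) := y) refl (h B) (h (suc B)) ⟩
    h (suc B)                                                   ∎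
    where open ≈-Reasoning

module RootsOfUnity {c ℓ} (R : CommutativeRing c ℓ) (ID : IsIntegralDomain R)
                    {η : CommutativeRing.Carrier R} {o′ : ℕ} (prim : Powers.IsPrimitiveRootOfUnity R η (suc o′)) where
  open CommutativeRing R hiding (zero)
  open IsIntegralDomain ID
  open IntegerImage R using (solve; _:+_; _:*_; :-_; _:-_; _:=_; con)
  open PowerSeries R
  private module ≈-Reasoning = Relation.Binary.Reasoning.Setoid setoid

  private
    o : ℕ
    o = suc o′

    ηᵒ≈1 : η ^ o ≈ 1#
    ηᵒ≈1 = proj₁ prim

    x-0≈x : ∀ x → x - 0# ≈ x
    x-0≈x = solve 1 (λ x → x :- con (+ 0) := x) refl

  -- Φ is [1- 1# u]· Φ′ by computation, as upTo o = 0 ∷ applyUpTo suc o′ and η ^ 0 = 1#.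
  Φ Φ′ : Seq
  Φ  = ∏[1- η ^_ u] upTo o · 1ₛ
  Φ′ = ∏[1- η ^_ u] applyUpTo suc o′ · 1ₛ

  Φ-0 : Φ 0 ≈ 1#
  Φ-0 = reflexive (∏-constantTerm (η ^_) (upTo o) 1ₛ)

  Φ′-degree : DegreeBelow o Φ′
  Φ′-degree = ≡.subst (λ B → DegreeBelow B Φ′)
    (≡.trans (≡.cong (ℕ._+ 1) (ListP.length-applyUpTo suc o′)) (ℕP.+-comm o′ 1))
    (∏-degree (η ^_) (applyUpTo suc o′) 1ₛ-degree)

  Φ-degree : DegreeBelow (suc o) Φ
  Φ-degree = ≡.subst (λ B → DegreeBelow B Φ)
    (≡.trans (≡.cong (ℕ._+ 1) (ListP.length-upTo o)) (ℕP.+-comm o 1))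
    (∏-degree (η ^_) (upTo o) 1ₛ-degree)

  -- Multiplying every root by η permutes the factors of Φ cyclically, since η ^ o = 1.
  Φ-scale-invariant : scale η Φ ≋ Φ
  Φ-scale-invariant = begin
    scale η Φ
      ≈⟨ scale-∏ η (η ^_) (upTo o) 1ₛ ⟩
    ∏[1- (λ i → η ^ i * η) u] upTo o · scale η 1ₛ
      ≈⟨ ∏-cong (upTo o) (λ i → *-comm _ _) (scale-1ₛ η) ⟩
    ∏[1- (η ^_) ∘ suc u] upTo o · 1ₛ
      ≡⟨ ∏-map (η ^_) suc (upTo o) 1ₛ ⟨
    ∏[1- η ^_ u] map suc (upTo o) · 1ₛ
      ≡⟨ ≡.cong (λ xs → ∏[1- η ^_ u] xs · 1ₛ) (≡.trans (ListP.map-upTo suc o) (≡.sym (ListP.applyUpTo-∷ʳ suc o′))) ⟩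
    ∏[1- η ^_ u] (applyUpTo suc o′ ∷ʳ o) · 1ₛ
      ≡⟨ ∏-++ (η ^_) (applyUpTo suc o′) [ o ] 1ₛ ⟩
    ∏[1- η ^_ u] applyUpTo suc o′ · [1- η ^ o u]· 1ₛ
      ≈⟨ ∏-cong (applyUpTo suc o′) (λ _ → refl) ([1-u]·-cong ηᵒ≈1 ≋-refl) ⟩
    ∏[1- η ^_ u] applyUpTo suc o′ · [1- 1# u]· 1ₛ
      ≈⟨ ∏-[1-u]·-comm (η ^_) (applyUpTo suc o′) 1# 1ₛ ⟩
    Φ
      ∎
    where open ≋-Reasoning

  Φ-middle : ∀ k → 0 < k → k < o → Φ k ≈ 0#
  Φ-middle k 0<k k<o with noZeroDiv (η ^ k - 1#) (Φ k) product≈0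
    where
      product≈0 : (η ^ k - 1#) * Φ k ≈ 0#
      product≈0 = begin
        (η ^ k - 1#) * Φ k  ≈⟨ solve 2 (λ x y → (x :- con (+ 1)) :* y := x :* y :- y) refl (η ^ k) (Φ k) ⟩
        η ^ k * Φ k - Φ k   ≈⟨ +-congʳ (Φ-scale-invariant k) ⟩
        Φ k - Φ k           ≈⟨ -‿inverseʳ _ ⟩
        0#                  ∎
        where open ≈-Reasoning
  ... | inj₂ cₖ≈0     = cₖ≈0
  ... | inj₁ ηᵏ-1≈0 = ⊥-elim (proj₂ prim k 0<k k<o (begin
    η ^ k              ≈⟨ solve 1 (λ x → x := (x :- con (+ 1)) :+ con (+ 1)) refl (η ^ k) ⟩
    (η ^ k - 1#) + 1#  ≈⟨ +-congʳ ηᵏ-1≈0 ⟩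
    0# + 1#            ≈⟨ +-identityˡ _ ⟩
    1#                 ∎))
    where open ≈-Reasoning

  -- Φ vanishes at u = 1 because of its factor 1 - u; all coefficients but Φ 0 and Φ o are already known.
  Φ-top : Φ o ≈ - 1#
  Φ-top = begin
    Φ o                        ≈⟨ solve 1 (λ x → x := (con (+ 1) :+ x) :- con (+ 1)) refl (Φ o) ⟩
    (1# + Φ o) - 1#            ≈⟨ +-congʳ (+-congʳ (partialSum-initial o′ ℕP.≤-refl)) ⟨
    partialSum Φ (suc o) - 1#  ≈⟨ +-congʳ (trans (partialSum-[1-u]· Φ′ o) (Φ′-degree o ℕP.≤-refl)) ⟩
    0# - 1#                    ≈⟨ +-identityˡ _ ⟩
    - 1#                       ∎
    where
      open ≈-Reasoning
      partialSum-initial : ∀ B → B < o → partialSum Φ (suc B) ≈ 1#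
      partialSum-initial zero    _     = trans (+-identityˡ _) Φ-0
      partialSum-initial (suc B) 1+B<o = trans
        (+-cong (partialSum-initial B (ℕP.<-trans (ℕP.n<1+n B) 1+B<o)) (Φ-middle (suc B) (s≤s z≤n) 1+B<o))
        (+-identityʳ _)

  cyclotomic : ∏[1- η ^_ u] upTo o · 1ₛ ≋ [1-u^ o ]· 1ₛ
  cyclotomic zero rewrite shift-< {o} {0} 1ₛ (s≤s z≤n) = trans Φ-0 (sym (x-0≈x 1#))
  cyclotomic (suc k) with ℕP.<-cmp (suc k) o
  ... | tri< k<o _ _ rewrite shift-< 1ₛ k<o = trans (Φ-middle (suc k) (s≤s z≤n) k<o) (sym (x-0≈x 0#))
  ... | tri≈ _ ≡.refl _ rewrite shift-≥ {o} {o} 1ₛ ℕP.≤-refl | ℕP.n∸n≡0 o = trans Φ-top (sym (+-identityˡ _))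
  ... | tri> _ _ o<k rewrite shift-≥ 1ₛ (ℕP.<⇒≤ o<k) with suc k ∸ o in eq
  ...   | zero  = ⊥-elim (ℕP.<⇒≢ (ℕP.m<n⇒0<n∸m o<k) (≡.sym eq))
  ...   | suc _ = trans (Φ-degree (suc k) o<k) (sym (x-0≈x 0#))

  cyclotomic-power : ∀ j → ∏[1- η ^_ u] upTo (j ℕ.* o) · 1ₛ ≋ [1-u^ o ]^ j · 1ₛ
  cyclotomic-power zero    = ≋-refl
  cyclotomic-power (suc j) = begin
    ∏[1- η ^_ u] upTo (o ℕ.+ j ℕ.* o) · 1ₛ
      ≡⟨ ∏-upTo-+ (η ^_) o (j ℕ.* o) 1ₛ ⟩
    ∏[1- η ^_ u] upTo o · ∏[1- (η ^_) ∘ (o ℕ.+_) u] upTo (j ℕ.* o) · 1ₛ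
      ≈⟨ ∏-cong (upTo o) (λ _ → refl) (∏-cong (upTo (j ℕ.* o)) (^-periodic {o = o} ηᵒ≈1) ≋-refl) ⟩
    ∏[1- η ^_ u] upTo o · ∏[1- η ^_ u] upTo (j ℕ.* o) · 1ₛ
      ≈⟨ ∏-cong (upTo o) (λ _ → refl) (cyclotomic-power j) ⟩
    ∏[1- η ^_ u] upTo o · [1-u^ o ]^ j · 1ₛ
      ≈⟨ ∏-[1-u^]^-comm (η ^_) (upTo o) o j 1ₛ ⟩
    [1-u^ o ]^ j · ∏[1- η ^_ u] upTo o · 1ₛ
      ≈⟨ [1-u^]^-cong o j cyclotomic ⟩
    [1-u^ o ]^ j · [1-u^ o ]· 1ₛ
      ≈⟨ [1-u^]^-suc o j 1ₛ ⟩
    [1-u^ o ]^ suc j · 1ₛ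
      ∎
    where open ≋-Reasoning

module IntegerSeries where
  open PowerSeries ℤP.+-*-commutativeRing
  open import Data.Integer.Solver using (module +-*-Solver)
  open +-*-Solver using (solve; _:+_; _:*_; _:-_; _:=_)

  conv-mono : ∀ d h j i → conv (mono d) h j i ≡ shift d (λ _ → h (j ∸ d)) i
  conv-mono zero    h j zero = ℤP.*-identityˡ (h j)
  conv-mono (suc d) h j zero = ℤP.*-zeroˡ (h j)
  conv-mono d h j (suc i) with d ℕ.≟ suc i | d ≤? i | d ≤? suc i | conv-mono d h j i
  ... | yes ≡.refl | yes d≤i | _      | _  = ⊥-elim (ℕP.<-irrefl ≡.refl d≤i)
  ... | yes ≡.refl | no _    | no d≰d | _  = ⊥-elim (d≰d ℕP.≤-refl)
  ... | yes ≡.refl | no _    | yes _  | ih = ≡.trans (≡.cong₂ ℤ._+_ (ℤP.*-identityˡ (h (j ∸ d))) ih) (ℤP.+-identityʳ _)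
  ... | no _       | yes d≤i | no d≰  | _  = ⊥-elim (d≰ (ℕP.m≤n⇒m≤1+n d≤i))
  ... | no d≢1+i   | no d≰i  | yes d≤ | _  = ⊥-elim (d≢1+i (ℕP.≤-antisym d≤ (ℕP.≰⇒> d≰i)))
  ... | no _       | yes _   | yes _  | ih = ≡.trans (≡.cong₂ ℤ._+_ (ℤP.*-zeroˡ (h (j ∸ suc i))) ih) (ℤP.+-identityˡ _)
  ... | no _       | no _    | no _   | ih = ≡.trans (≡.cong₂ ℤ._+_ (ℤP.*-zeroˡ (h (j ∸ suc i))) ih) (ℤP.+-identityˡ _)

  mono-⊛ : ∀ d h → mono d ⊛ h ≋ shift d h
  mono-⊛ d h j with d ≤? j | conv-mono d h j j
  ... | yes _ | eq = eq
  ... | no  _ | eq = eq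

  ⊖ₛ-⊛ : ∀ f g h → (f ⊖ₛ g) ⊛ h ≋ (f ⊛ h) ⊖ₛ (g ⊛ h)
  ⊖ₛ-⊛ f g h j = go j
    where
      go : ∀ i → conv (f ⊖ₛ g) h j i ≡ conv f h j i ℤ.- conv g h j i
      go zero    = solve 3 (λ a b x → (a :- b) :* x := a :* x :- b :* x) ≡.refl (f 0) (g 0) (h j)
      go (suc i) = ≡.trans (≡.cong (ℤ._+_ ((f (suc i) ℤ.- g (suc i)) ℤ.* h (j ∸ suc i))) (go i))
        (solve 5 (λ a b x X Y → (a :- b) :* x :+ (X :- Y) := (a :* x :+ X) :- (b :* x :+ Y)) ≡.refl
          (f (suc i)) (g (suc i)) (h (j ∸ suc i)) (conv f h j i) (conv g h j i))

  ⊛-⊖ₛ : ∀ f g h → f ⊛ (g ⊖ₛ h) ≋ (f ⊛ g) ⊖ₛ (f ⊛ h)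
  ⊛-⊖ₛ f g h j = go j
    where
      go : ∀ i → conv f (g ⊖ₛ h) j i ≡ conv f g j i ℤ.- conv f h j i
      go zero    = solve 3 (λ a x y → a :* (x :- y) := a :* x :- a :* y) ≡.refl (f 0) (g j) (h j)
      go (suc i) = ≡.trans (≡.cong (ℤ._+_ (f (suc i) ℤ.* (g (j ∸ suc i) ℤ.- h (j ∸ suc i)))) (go i))
        (solve 5 (λ a x y X Y → a :* (x :- y) :+ (X :- Y) := (a :* x :+ X) :- (a :* y :+ Y)) ≡.refl
          (f (suc i)) (g (j ∸ suc i)) (h (j ∸ suc i)) (conv f g j i) (conv f h j i))

  ⊛-congʳ : ∀ f {g g′} → g ≋ g′ → f ⊛ g ≋ f ⊛ g′
  ⊛-congʳ f {g} {g′} g≋g′ j = go j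
    where
      go : ∀ i → conv f g j i ≡ conv f g′ j i
      go zero    = ≡.cong (f 0 ℤ.*_) (g≋g′ j)
      go (suc i) = ≡.cong₂ ℤ._+_ (≡.cong (f (suc i) ℤ.*_) (g≋g′ (j ∸ suc i))) (go i)

  ⊛-identityʳ : ∀ f → f ⊛ mono 0 ≋ f
  ⊛-identityʳ f zero    = ℤP.*-identityʳ (f 0)
  ⊛-identityʳ f (suc j) = begin
    f (suc j) ℤ.* mono 0 (j ∸ j) ℤ.+ conv f (mono 0) (suc j) j
      ≡⟨ ≡.cong₂ ℤ._+_ (≡.cong (λ t → f (suc j) ℤ.* mono 0 t) (ℕP.n∸n≡0 j)) (vanishes j ℕP.≤-refl) ⟩
    f (suc j) ℤ.* + 1 ℤ.+ + 0
      ≡⟨ ≡.trans (ℤP.+-identityʳ _) (ℤP.*-identityʳ _) ⟩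
    f (suc j)
      ∎
    where
      open ≡.≡-Reasoning
      vanishes : ∀ i → i ≤ j → conv f (mono 0) (suc j) i ≡ + 0
      vanishes zero    _   = ℤP.*-zeroʳ (f 0)
      vanishes (suc i) i<j = ≡.trans
        (≡.cong₂ ℤ._+_ (≡.trans (≡.cong (λ t → f (suc i) ℤ.* mono 0 t) (ℕP.+-∸-assoc 1 i<j)) (ℤP.*-zeroʳ (f (suc i))))
                       (vanishes i (ℕP.<⇒≤ i<j)))
        (ℤP.+-identityʳ _)

  ⊛-shift : ∀ f h d → 0 < d → f ⊛ shift d h ≋ shift d (f ⊛ h)
  ⊛-shift f h d 0<d j with d ≤? j
  ... | no d≰j  = below j (ℕP.≰⇒> d≰j)
    where
      below : ∀ i → j < d → conv f (shift d h) j i ≡ + 0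
      below zero    j<d = ≡.trans (≡.cong (f 0 ℤ.*_) (shift-< h j<d)) (ℤP.*-zeroʳ (f 0))
      below (suc i) j<d = ≡.trans
        (≡.cong₂ ℤ._+_ (≡.trans (≡.cong (f (suc i) ℤ.*_) (shift-< h (ℕP.≤-<-trans (ℕP.m∸n≤m j (suc i)) j<d))) (ℤP.*-zeroʳ (f (suc i))))
                       (below i j<d))
        (ℤP.+-identityʳ _)
  ... | yes d≤j = ≡.subst (λ t → conv f (shift d h) t t ≡ conv f h (j ∸ d) (j ∸ d)) (ℕP.m∸n+n≡m d≤j)
                    (high (j ∸ d) (j ∸ d ℕ.+ d) (ℕP.m≤m+n (j ∸ d) d))
    where
      shifted : ∀ e t → t ≤ e → shift d h (e ℕ.+ d ∸ t) ≡ h (e ∸ t)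
      shifted e t t≤e = ≡.trans (≡.cong (shift d h) (ℕP.+-∸-comm d t≤e))
                          (≡.trans (shift-≥ h (ℕP.m≤n+m d (e ∸ t))) (≡.cong h (ℕP.m+n∸n≡m (e ∸ t) d)))
      out-of-range : ∀ e t → e < t → shift d h (e ℕ.+ d ∸ t) ≡ + 0
      out-of-range e t e<t with t ≤? e ℕ.+ d
      ... | yes t≤e+d = shift-< h (≡.subst (e ℕ.+ d ∸ t <_) (ℕP.m+n∸m≡n e d) (ℕP.∸-monoʳ-< e<t t≤e+d))
      ... | no  t≰e+d = shift-< h (≡.subst (_< d) (≡.sym (ℕP.m≤n⇒m∸n≡0 (ℕP.<⇒≤ (ℕP.≰⇒> t≰e+d)))) 0<d)
      low : ∀ e i → i ≤ e → conv f (shift d h) (e ℕ.+ d) i ≡ conv f h e i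
      low e zero    _   = ≡.cong (f 0 ℤ.*_) (shifted e 0 z≤n)
      low e (suc i) i<e = ≡.cong₂ ℤ._+_ (≡.cong (f (suc i) ℤ.*_) (shifted e (suc i) i<e)) (low e i (ℕP.<⇒≤ i<e))
      high : ∀ e i → e ≤ i → conv f (shift d h) (e ℕ.+ d) i ≡ conv f h e e
      high e zero    z≤n = low 0 0 z≤n
      high e (suc i) e≤1+i with e ≤? i
      ... | yes e≤i = ≡.trans (≡.cong₂ ℤ._+_ (≡.trans (≡.cong (f (suc i) ℤ.*_) (out-of-range e (suc i) (s≤s e≤i))) (ℤP.*-zeroʳ (f (suc i))))
                                              (high e i e≤i))
                              (ℤP.+-identityˡ _)
      ... | no  e≰i with ℕP.≤-antisym e≤1+i (ℕP.≰⇒> e≰i)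
      ...   | ≡.refl = low (suc i) (suc i) ℕP.≤-refl

  oneMinus-⊛ : ∀ d h → oneMinus d ⊛ h ≋ [1-u^ d ]· h
  oneMinus-⊛ d h j = ≡.trans (⊖ₛ-⊛ (mono 0) (mono d) h j)
    (≡.cong₂ ℤ._-_ (≡.trans (mono-⊛ 0 h j) (shift-≥ h z≤n)) (mono-⊛ d h j))

  oneMinus^ : ∀ d M → oneMinus d ^ₛ M ≋ [1-u^ d ]^ M · mono 0
  oneMinus^ d zero    = ≋-refl
  oneMinus^ d (suc M) = ≋-trans (oneMinus-⊛ d _) ([1-u^]·-cong d (oneMinus^ d M))

  ⊛-oneMinus^ : ∀ f d → 0 < d → ∀ M → f ⊛ (oneMinus d ^ₛ M) ≋ [1-u^ d ]^ M · f
  ⊛-oneMinus^ f d 0<d zero    = ⊛-identityʳ f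
  ⊛-oneMinus^ f d 0<d (suc M) = ≋-trans (⊛-congʳ f (oneMinus-⊛ d _))
    (≋-trans ⊛-[1-u^]· ([1-u^]·-cong d (⊛-oneMinus^ f d 0<d M)))
    where
      ⊛-[1-u^]· : ∀ {h} → f ⊛ ([1-u^ d ]· h) ≋ [1-u^ d ]· (f ⊛ h)
      ⊛-[1-u^]· {h} j = ≡.trans (⊛-⊖ₛ f h (shift d h) j) (≡.cong (λ t → (f ⊛ h) j ℤ.- t) (⊛-shift f h d 0<d j))

module IntegerSeriesImage {c ℓ} (R : CommutativeRing c ℓ) where
  open CommutativeRing R hiding (zero)
  open IntegerImage R
  open PowerSeries R
  private module ℤₛ = PowerSeries ℤP.+-*-commutativeRing
  open import Relation.Binary.Reasoning.Setoid setoid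

  ιₛ : Series → Seq
  ιₛ h k = ι (h k)

  ιₛ-cong : ∀ {g h} → g ℤₛ.≋ h → ιₛ g ≋ ιₛ h
  ιₛ-cong g≋h k = reflexive (≡.cong ι (g≋h k))

  ιₛ-mono0 : ιₛ (mono 0) ≋ 1ₛ
  ιₛ-mono0 zero    = refl
  ιₛ-mono0 (suc k) = refl

  ιₛ-[1-u^]^ : ∀ d M h → ιₛ (ℤₛ.[1-u^ d ]^ M · h) ≋ [1-u^ d ]^ M · ιₛ h
  ιₛ-[1-u^]^ d zero    h = ≋-refl
  ιₛ-[1-u^]^ d (suc M) h = ≋-trans (ιₛ-[1-u^]· (ℤₛ.[1-u^ d ]^ M · h)) ([1-u^]·-cong d (ιₛ-[1-u^]^ d M h))
    where
      ιₛ-shift : ∀ g k → ι (ℤₛ.shift d g k) ≈ shift d (ιₛ g) k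
      ιₛ-shift g k with d ≤? k
      ... | yes _ = refl
      ... | no  _ = refl
      ιₛ-[1-u^]· : ∀ g → ιₛ (ℤₛ.[1-u^ d ]· g) ≋ [1-u^ d ]· ιₛ g
      ιₛ-[1-u^]· g k = trans (ι-+ (g k) (ℤ.- ℤₛ.shift d g k)) (+-congˡ (trans (ι-neg (ℤₛ.shift d g k)) (-‿cong (ιₛ-shift g k))))

  ιₛ-oneMinus^ : ∀ d M → ιₛ (oneMinus d ^ₛ M) ≋ [1-u^ d ]^ M · 1ₛ
  ιₛ-oneMinus^ d M = ≋-trans (ιₛ-cong (IntegerSeries.oneMinus^ d M)) (≋-trans (ιₛ-[1-u^]^ d M (mono 0)) ([1-u^]^-cong d M ιₛ-mono0))

  fromℤ-signedCoeff : ∀ k S → fromℤ R (signedCoeff k S) ≈ (- 1#) ^ k * ιℕ (k !) * ι (S k)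
  fromℤ-signedCoeff k S = begin
    fromℤ R (signedCoeff k S)                   ≈⟨ fromℤ≈ι (signedCoeff k S) ⟩
    ι ((-[1+ 0 ] ℤ.^ k) ℤ.* + (k !) ℤ.* S k)    ≈⟨ ι-* ((-[1+ 0 ] ℤ.^ k) ℤ.* + (k !)) (S k) ⟩
    ι ((-[1+ 0 ] ℤ.^ k) ℤ.* + (k !)) * ι (S k)  ≈⟨ *-congʳ (trans (ι-* (-[1+ 0 ] ℤ.^ k) (+ (k !))) (*-congʳ (ι-sign k))) ⟩
    (- 1#) ^ k * ιℕ (k !) * ι (S k)             ∎
    where
      ι-sign : ∀ k → ι (-[1+ 0 ] ℤ.^ k) ≈ (- 1#) ^ k
      ι-sign zero    = refl
      ι-sign (suc k) = trans (ι-* -[1+ 0 ] (-[1+ 0 ] ℤ.^ k)) (*-congˡ (ι-sign k))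

module DistinctTupleSums {c ℓ} (R : CommutativeRing c ℓ) {N : ℕ} (ψ : Fin N → CommutativeRing.Carrier R) where
  open CommutativeRing R hiding (zero)
  open IntegerImage R using (solve; _:+_; _:*_; :-_; _:-_; _:=_; con; ιℕ; ιℕ-suc; ιℕ-*)
  open PowerSeries R
  open import Algebra.Properties.CommutativeMonoid.Sum +-commutativeMonoid using (sum; sum-cong-≋; sum-replicate-zero; ∑-distrib-+)
  open import Algebra.Properties.Semiring.Sum semiring using (*-distribˡ-sum)
  open import Relation.Binary.Reasoning.Setoid setoid

  infixl 7 _─_
  _─_ : (Fin N → Bool) → Fin N → Fin N → Bool
  (S ─ a) x = S x ∧ not (does (x Fin.≟ a))

  sumDistinct : (Fin N → Bool) → ℕ → Carrier
  sumDistinct S zero    = 1#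
  sumDistinct S (suc k) = sum (λ y → if S y then ψ y * sumDistinct (S ─ y) k else 0#)

  if-congʳ : ∀ b {x y} → x ≈ y → (if b then x else 0#) ≈ (if b then y else 0#)
  if-congʳ true  x≈y = x≈y
  if-congʳ false _   = refl

  sumDistinct-cong : ∀ k {S S′} → (∀ x → S x ≡ S′ x) → sumDistinct S k ≈ sumDistinct S′ k
  sumDistinct-cong zero    S≗S′ = refl
  sumDistinct-cong (suc k) {S} {S′} S≗S′ = sum-cong-≋ per
    where
      per : ∀ y → (if S y then ψ y * sumDistinct (S ─ y) k else 0#) ≈ (if S′ y then ψ y * sumDistinct (S′ ─ y) k else 0#)
      per y rewrite S≗S′ y = if-congʳ (S′ y) (*-congˡ (sumDistinct-cong k (λ x → ≡.cong (_∧ not (does (x Fin.≟ y))) (S≗S′ x))))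

  sum-zeros : ∀ {n} (f : Fin n → Carrier) → (∀ y → f y ≈ 0#) → sum f ≈ 0#
  sum-zeros {n} f zeros = trans (sum-cong-≋ zeros) (sum-replicate-zero n)

  sum-single : ∀ {n} (a : Fin n) (f : Fin n → Carrier) → (∀ y → ¬ y ≡ a → f y ≈ 0#) → sum f ≈ f a
  sum-single Fin.zero    f zeros = trans (+-congˡ (sum-zeros (f ∘ Fin.suc) (λ y → zeros (Fin.suc y) λ ()))) (+-identityʳ _)
  sum-single (Fin.suc a) f zeros = trans
    (+-cong (zeros Fin.zero λ ()) (sum-single a (f ∘ Fin.suc) (λ y y≢a → zeros (Fin.suc y) (y≢a ∘ FinP.suc-injective))))
    (+-identityˡ _)

  sumDistinct-split : ∀ k S a → S a ≡ true →
    sumDistinct S (suc k) ≈ ψ a * sumDistinct (S ─ a) k + sum (λ y → if (S ─ a) y then ψ y * sumDistinct (S ─ y) k else 0#)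
  sumDistinct-split k S a Sa = begin
    sum (λ y → if S y then G y else 0#)
      ≈⟨ sum-cong-≋ split ⟩
    sum (λ y → (if does (y Fin.≟ a) then (if S y then G y else 0#) else 0#) + (if (S ─ a) y then G y else 0#))
      ≈⟨ ∑-distrib-+ (λ y → if does (y Fin.≟ a) then (if S y then G y else 0#) else 0#) (λ y → if (S ─ a) y then G y else 0#) ⟩
    sum (λ y → if does (y Fin.≟ a) then (if S y then G y else 0#) else 0#) + sum (λ y → if (S ─ a) y then G y else 0#)
      ≈⟨ +-congʳ (sum-single a _ (λ y y≢a → reflexive (≡.cong (λ b → if b then (if S y then G y else 0#) else 0#) (dec-false (y Fin.≟ a) y≢a)))) ⟩
    (if does (a Fin.≟ a) then (if S a then G a else 0#) else 0#) + sum (λ y → if (S ─ a) y then G y else 0#)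
      ≡⟨ ≡.cong₂ (λ b b′ → (if b then (if b′ then G a else 0#) else 0#) + sum (λ y → if (S ─ a) y then G y else 0#))
                 (dec-true (a Fin.≟ a) ≡.refl) Sa ⟩
    G a + sum (λ y → if (S ─ a) y then G y else 0#)
      ∎
    where
      G : Fin N → Carrier
      G y = ψ y * sumDistinct (S ─ y) k
      split : ∀ y → (if S y then G y else 0#) ≈ (if does (y Fin.≟ a) then (if S y then G y else 0#) else 0#) + (if (S ─ a) y then G y else 0#)
      split y with y Fin.≟ a | S y
      ... | yes _ | true  = sym (+-identityʳ _)
      ... | yes _ | false = sym (+-identityʳ _)
      ... | no  _ | true  = sym (+-identityˡ _)
      ... | no  _ | false = sym (+-identityˡ _)

  ─-true : ∀ S {a x} → S x ≡ true → ¬ x ≡ a → (S ─ a) x ≡ true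
  ─-true S {a} {x} Sx x≢a rewrite Sx | dec-false (x Fin.≟ a) x≢a = ≡.refl

  ─-true⁻ˡ : ∀ S {a x} → (S ─ a) x ≡ true → S x ≡ true
  ─-true⁻ˡ S {a} {x} eq with S x
  ... | true = ≡.refl

  ─-true⁻ʳ : ∀ S {a x} → (S ─ a) x ≡ true → ¬ x ≡ a
  ─-true⁻ʳ S {a} {x} eq with S x | x Fin.≟ a
  ... | true | no x≢a = x≢a

  ─-comm : ∀ S a b x → ((S ─ a) ─ b) x ≡ ((S ─ b) ─ a) x
  ─-comm S a b x with S x | does (x Fin.≟ a) | does (x Fin.≟ b)
  ... | true  | true  | true  = ≡.refl
  ... | true  | true  | false = ≡.refl
  ... | true  | false | true  = ≡.refl
  ... | true  | false | false = ≡.refl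
  ... | false | _     | _     = ≡.refl

  -- Deleting a from S: the tuples avoiding a, plus those containing a in one of k + 1 positions.
  sumDistinct-remove : ∀ k S a → S a ≡ true →
    sumDistinct S (suc k) ≈ sumDistinct (S ─ a) (suc k) + ιℕ (suc k) * ψ a * sumDistinct (S ─ a) k
  sumDistinct-remove zero    S a Sa = trans (sumDistinct-split zero S a Sa)
    (solve 2 (λ p X → p :* con (+ 1) :+ X := X :+ con (+ 1) :* p :* con (+ 1)) refl (ψ a) _)
  sumDistinct-remove (suc k) S a Sa = begin
    sumDistinct S (suc (suc k))
      ≈⟨ sumDistinct-split (suc k) S a Sa ⟩
    ψ a * sumDistinct (S ─ a) (suc k) + sum (λ y → if (S ─ a) y then ψ y * sumDistinct (S ─ y) (suc k) else 0#)
      ≈⟨ +-congˡ (trans (sum-cong-≋ per) (trans (∑-distrib-+ _ (λ y → n * ψ a * T y k)) (+-congˡ (sym (*-distribˡ-sum (n * ψ a) (λ y → T y k)))))) ⟩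
    ψ a * X₁ + (X₂ + n * ψ a * X₁)
      ≈⟨ solve 4 (λ p X Y n → p :* X :+ (Y :+ n :* p :* X) := Y :+ (con (+ 1) :+ n) :* p :* X) refl (ψ a) X₁ X₂ n ⟩
    X₂ + (1# + n) * ψ a * X₁
      ≈⟨ +-congˡ (*-congʳ (*-congʳ (ιℕ-suc (suc k)))) ⟨
    sumDistinct (S ─ a) (suc (suc k)) + ιℕ (suc (suc k)) * ψ a * sumDistinct (S ─ a) (suc k) ∎
    where
      n X₁ X₂ : Carrier
      n  = ιℕ (suc k)
      X₁ = sumDistinct (S ─ a) (suc k)
      X₂ = sumDistinct (S ─ a) (suc (suc k))
      T : Fin N → ℕ → Carrier
      T y j = if (S ─ a) y then ψ y * sumDistinct ((S ─ a) ─ y) j else 0#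
      per : ∀ y → (if (S ─ a) y then ψ y * sumDistinct (S ─ y) (suc k) else 0#)
                ≈ (if (S ─ a) y then ψ y * sumDistinct ((S ─ a) ─ y) (suc k) else 0#)
                  + n * ψ a * (if (S ─ a) y then ψ y * sumDistinct ((S ─ a) ─ y) k else 0#)
      per y with (S ─ a) y in eq
      ... | false = solve 2 (λ n p → con (+ 0) := con (+ 0) :+ n :* p :* con (+ 0)) refl n (ψ a)
      ... | true  = begin
        ψ y * sumDistinct (S ─ y) (suc k)
          ≈⟨ *-congˡ (sumDistinct-remove k (S ─ y) a (─-true S Sa (λ a≡y → y≢a (≡.sym a≡y)))) ⟩
        ψ y * (sumDistinct ((S ─ y) ─ a) (suc k) + n * ψ a * sumDistinct ((S ─ y) ─ a) k)
          ≈⟨ *-congˡ (+-cong (sumDistinct-cong (suc k) (─-comm S y a)) (*-congˡ (sumDistinct-cong k (─-comm S y a)))) ⟩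
        ψ y * (sumDistinct ((S ─ a) ─ y) (suc k) + n * ψ a * sumDistinct ((S ─ a) ─ y) k)
          ≈⟨ solve 5 (λ q X n p Y → q :* (X :+ n :* p :* Y) := q :* X :+ n :* p :* (q :* Y)) refl (ψ y) _ n (ψ a) _ ⟩
        ψ y * sumDistinct ((S ─ a) ─ y) (suc k) + n * ψ a * (ψ y * sumDistinct ((S ─ a) ─ y) k) ∎
        where
          y≢a : ¬ y ≡ a
          y≢a = ─-true⁻ʳ S eq

  -- (1 - ψ x₁ u) ⋯ (1 - ψ xₘ u) = Σₖ (-1)ᵏ eₖ(ψ x₁, …, ψ xₘ) uᵏ, and sumDistinct S k = k! eₖ
  sumDistinct-∏ : ∀ xs S → Unique xs → (∀ x → S x ≡ true ⇔ x ∈ xs) →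
    ∀ k → sumDistinct S k ≈ (- 1#) ^ k * ιℕ (k !) * (∏[1- ψ u] xs · 1ₛ) k
  sumDistinct-∏ []       S _ S⇔∈ zero    = solve 0 (con (+ 1) := con (+ 1) :* con (+ 1) :* con (+ 1)) refl
  sumDistinct-∏ []       S _ S⇔∈ (suc k) = trans (sum-zeros _ absent) (sym (zeroʳ _))
    where
      absent : ∀ y → (if S y then ψ y * sumDistinct (S ─ y) k else 0#) ≈ 0#
      absent y with S y in Sy
      ... | true  with () ← Equivalence.to (S⇔∈ y) Sy
      ... | false = refl
  sumDistinct-∏ (a ∷ xs) S (a∉xs ∷ xs-unique) S⇔∈ zero =
    sym (trans (*-congˡ (reflexive (∏-constantTerm ψ (a ∷ xs) 1ₛ))) (solve 0 (con (+ 1) :* con (+ 1) :* con (+ 1) := con (+ 1)) refl))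
  sumDistinct-∏ (a ∷ xs) S (a∉xs ∷ xs-unique) S⇔∈ (suc k) = begin
    sumDistinct S (suc k)
      ≈⟨ sumDistinct-remove k S a (Equivalence.from (S⇔∈ a) (here ≡.refl)) ⟩
    sumDistinct (S ─ a) (suc k) + ιℕ (suc k) * ψ a * sumDistinct (S ─ a) k
      ≈⟨ +-cong (IH (suc k)) (*-congˡ (IH k)) ⟩
    - 1# * s * ιℕ (suc k ℕ.* k !) * E (suc k) + ιℕ (suc k) * ψ a * (s * ιℕ (k !) * E k)
      ≈⟨ +-congʳ (*-congʳ (*-congˡ (ιℕ-* (suc k) (k !)))) ⟩
    - 1# * s * (ιℕ (suc k) * ιℕ (k !)) * E (suc k) + ιℕ (suc k) * ψ a * (s * ιℕ (k !) * E k)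
      ≈⟨ solve 6 (λ s f n p e₁ e₀ → (con -[1+ 0 ] :* s) :* (n :* f) :* e₁ :+ n :* p :* (s :* f :* e₀)
                                  := (con -[1+ 0 ] :* s) :* (n :* f) :* (e₁ :- p :* e₀))
                 refl s (ιℕ (k !)) (ιℕ (suc k)) (ψ a) (E (suc k)) (E k) ⟩
    - 1# * s * (ιℕ (suc k) * ιℕ (k !)) * (E (suc k) - ψ a * E k)
      ≈⟨ *-congʳ (*-congˡ (ιℕ-* (suc k) (k !))) ⟨
    (- 1#) ^ suc k * ιℕ (suc k !) * (∏[1- ψ u] a ∷ xs · 1ₛ) (suc k) ∎
    where
      s : Carrier
      s = (- 1#) ^ k
      E : Seq
      E = ∏[1- ψ u] xs · 1ₛ
      S─a⇔∈ : ∀ x → (S ─ a) x ≡ true ⇔ x ∈ xs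
      S─a⇔∈ x = mk⇔
        (λ eq → case Equivalence.to (S⇔∈ x) (─-true⁻ˡ S eq) of λ where
          (here x≡a)  → ⊥-elim (─-true⁻ʳ S eq x≡a)
          (there x∈xs) → x∈xs)
        (λ x∈xs → ─-true S (Equivalence.from (S⇔∈ x) (there x∈xs)) (λ x≡a → ListAll.lookup a∉xs x∈xs (≡.sym x≡a)))
      IH : ∀ k → sumDistinct (S ─ a) k ≈ (- 1#) ^ k * ιℕ (k !) * E k
      IH = sumDistinct-∏ xs (S ─ a) xs-unique S─a⇔∈

  sumList : {A : Set} → (A → Carrier) → List A → Carrier
  sumList g []       = 0#
  sumList g (x ∷ xs) = g x + sumList g xs

  sumList-cong : ∀ {A : Set} {f g : A → Carrier} xs → (∀ x → f x ≈ g x) → sumList f xs ≈ sumList g xs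
  sumList-cong []       f≈g = refl
  sumList-cong (x ∷ xs) f≈g = +-cong (f≈g x) (sumList-cong xs f≈g)

  sumList-++ : ∀ {A : Set} (g : A → Carrier) xs ys → sumList g (xs ++ ys) ≈ sumList g xs + sumList g ys
  sumList-++ g []       ys = sym (+-identityˡ _)
  sumList-++ g (x ∷ xs) ys = trans (+-congˡ (sumList-++ g xs ys)) (sym (+-assoc _ _ _))

  sumList-concatMap : ∀ {A B : Set} (g : B → Carrier) (f : A → List B) xs →
                      sumList g (concatMap f xs) ≈ sumList (sumList g ∘ f) xs
  sumList-concatMap g f []       = refl
  sumList-concatMap g f (x ∷ xs) = trans (sumList-++ g (f x) (concatMap f xs)) (+-congˡ (sumList-concatMap g f xs))

  sumList-map : ∀ {A B : Set} (g : B → Carrier) (h : A → B) xs → sumList g (map h xs) ≡ sumList (g ∘ h) xs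
  sumList-map g h []       = ≡.refl
  sumList-map g h (x ∷ xs) = ≡.cong (_+_ (g (h x))) (sumList-map g h xs)

  sumList-tabulate : ∀ {n} {A : Set} (g : A → Carrier) (h : Fin n → A) → sumList g (tabulate h) ≡ sum (g ∘ h)
  sumList-tabulate {zero}  g h = ≡.refl
  sumList-tabulate {suc n} g h = ≡.cong (_+_ (g (h Fin.zero))) (sumList-tabulate g (h ∘ Fin.suc))

  sumList-if-* : ∀ {A : Set} b x (f : A → Carrier) xs →
                 sumList (λ v → if b then x * f v else 0#) xs ≈ (if b then x * sumList f xs else 0#)
  sumList-if-* true  x f []       = sym (zeroʳ x)
  sumList-if-* false x f []       = refl
  sumList-if-* true  x f (v ∷ xs) = trans (+-congˡ (sumList-if-* true x f xs)) (sym (distribˡ _ _ _))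
  sumList-if-* false x f (v ∷ xs) = trans (+-congˡ (sumList-if-* false x f xs)) (+-identityˡ _)

  F-filter : ∀ {k} {Q : Pred (Vec (Fin N) k) 0ℓ} (Q? : Decidable Q) xs →
             F R ψ (filter Q? xs) ≈ sumList (λ v → if does (Q? v) then prodψ R ψ v else 0#) xs
  F-filter Q? []       = refl
  F-filter Q? (v ∷ xs) with does (Q? v)
  ... | true  = +-congˡ (F-filter Q? xs)
  ... | false = trans (F-filter Q? xs) (sym (+-identityˡ _))

  DistinctIn : Pred (Fin N) 0ℓ → ∀ {k} → Vec (Fin N) k → Set
  DistinctIn P v = VecAll.All P v × VecUnique v

  distinctIn? : ∀ {P : Pred (Fin N) 0ℓ} → Decidable P → ∀ {k} → Decidable (DistinctIn P {k})
  distinctIn? P? v = VecAll.all? P? v ×-dec allPairs? (λ x y → ¬? (x Fin.≟ y)) v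

  _─?_ : ∀ {P : Pred (Fin N) 0ℓ} → Decidable P → (a : Fin N) → Decidable (λ x → P x × ¬ x ≡ a)
  (P? ─? a) x = P? x ×-dec ¬? (x Fin.≟ a)

  does-distinctIn?-∷ : ∀ {P : Pred (Fin N) 0ℓ} (P? : Decidable P) y {k} (v : Vec (Fin N) k) →
    does (distinctIn? P? (y ∷ᵥ v)) ≡ does (P? y) ∧ does (distinctIn? (P? ─? y) v)
  does-distinctIn?-∷ {P} P? y v = does-⇔ (mk⇔ to from) (distinctIn? P? (y ∷ᵥ v)) (P? y ×-dec distinctIn? (P? ─? y) v)
    where
      flip≢ : ∀ {x z : Fin N} → ¬ x ≡ z → ¬ z ≡ x
      flip≢ x≢z z≡x = x≢z (≡.sym z≡x)
      to : DistinctIn P (y ∷ᵥ v) → P y × DistinctIn (λ x → P x × ¬ x ≡ y) v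
      to (Py VecAll.∷ Pv , y∉v AllPairs.∷ v-unique) = Py , VecAll.zip (Pv , VecAll.map flip≢ y∉v) , v-unique
      from : P y × DistinctIn (λ x → P x × ¬ x ≡ y) v → DistinctIn P (y ∷ᵥ v)
      from (Py , P─yv , v-unique) with Pv , v≢y ← VecAll.unzip P─yv = Py VecAll.∷ Pv , VecAll.map flip≢ v≢y AllPairs.∷ v-unique

  F≈sumDistinct : ∀ k {P : Pred (Fin N) 0ℓ} (P? : Decidable P) →
                  F R ψ (filter (distinctIn? P?) (allTuples N k)) ≈ sumDistinct (does ∘ P?) k
  F≈sumDistinct zero    P? = +-identityʳ 1#
  F≈sumDistinct (suc k) P? = begin
    F R ψ (filter (distinctIn? P?) (allTuples N (suc k)))
      ≈⟨ F-filter (distinctIn? P?) (allTuples N (suc k)) ⟩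
    sumList g (concatMap (λ y → map (y ∷ᵥ_) (allTuples N k)) (allFin N))
      ≈⟨ sumList-concatMap g (λ y → map (y ∷ᵥ_) (allTuples N k)) (allFin N) ⟩
    sumList (λ y → sumList g (map (y ∷ᵥ_) (allTuples N k))) (allFin N)
      ≡⟨ sumList-tabulate (λ y → sumList g (map (y ∷ᵥ_) (allTuples N k))) id ⟩
    sum (λ y → sumList g (map (y ∷ᵥ_) (allTuples N k)))
      ≈⟨ sum-cong-≋ per ⟩
    sumDistinct (does ∘ P?) (suc k) ∎
    where
      g : Vec (Fin N) (suc k) → Carrier
      g v = if does (distinctIn? P? v) then prodψ R ψ v else 0#
      if-∧ : ∀ b b′ x y → (if b ∧ b′ then x * y else 0#) ≈ (if b then x * (if b′ then y else 0#) else 0#)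
      if-∧ true  true  x y = refl
      if-∧ true  false x y = sym (zeroʳ x)
      if-∧ false b′    x y = refl
      per : ∀ y → sumList g (map (y ∷ᵥ_) (allTuples N k)) ≈ (if does (P? y) then ψ y * sumDistinct ((does ∘ P?) ─ y) k else 0#)
      per y = begin
        sumList g (map (y ∷ᵥ_) (allTuples N k))
          ≡⟨ sumList-map g (y ∷ᵥ_) (allTuples N k) ⟩
        sumList (g ∘ (y ∷ᵥ_)) (allTuples N k)
          ≈⟨ sumList-cong (allTuples N k) (λ v → trans (reflexive (≡.cong (λ b → if b then ψ y * prodψ R ψ v else 0#) (does-distinctIn?-∷ P? y v)))
                                                      (if-∧ (does (P? y)) _ (ψ y) (prodψ R ψ v))) ⟩
        sumList (λ v → if does (P? y) then ψ y * (if does (distinctIn? (P? ─? y) v) then prodψ R ψ v else 0#) else 0#) (allTuples N k)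
          ≈⟨ sumList-if-* (does (P? y)) (ψ y) _ (allTuples N k) ⟩
        (if does (P? y) then ψ y * sumList (λ v → if does (distinctIn? (P? ─? y) v) then prodψ R ψ v else 0#) (allTuples N k) else 0#)
          ≈⟨ if-congʳ (does (P? y)) (*-congˡ (trans (sym (F-filter (distinctIn? (P? ─? y)) (allTuples N k))) (F≈sumDistinct k (P? ─? y)))) ⟩
        (if does (P? y) then ψ y * sumDistinct ((does ∘ P?) ─ y) k else 0#) ∎

module Characters {c ℓ} (R : CommutativeRing c ℓ) {m : ℕ} (ψ : Fin (suc (suc m)) → CommutativeRing.Carrier R)
                  (χ : IsCharacter R ψ) where
  open CommutativeRing R hiding (zero)
  open Powers R
  open IsCharacter χ
  open import Relation.Binary.Reasoning.Setoid setoid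

  private
    N : ℕ
    N = suc (suc m)

    1ᴳ : Fin N
    1ᴳ = Fin.suc Fin.zero

    toℕ-⊕ : ∀ (a b : Fin N) → toℕ (a ⊕ b) ≡ (toℕ a ℕ.+ toℕ b) % N
    toℕ-⊕ a b = FinP.toℕ-fromℕ< _

  ζ : Carrier
  ζ = ψ 1ᴳ

  ψ[0]≈1 : ψ Fin.zero ≈ 1#
  ψ[0]≈1 with y , ψ0*y≈1 ← unit Fin.zero = begin
    ψ 0ᴳ               ≈⟨ *-identityʳ _ ⟨
    ψ 0ᴳ * 1#          ≈⟨ *-congˡ ψ0*y≈1 ⟨
    ψ 0ᴳ * (ψ 0ᴳ * y)  ≈⟨ *-assoc _ _ _ ⟨
    (ψ 0ᴳ * ψ 0ᴳ) * y  ≈⟨ *-congʳ (trans (reflexive (≡.cong ψ (FinP.toℕ-injective (≡.sym (toℕ-⊕ 0ᴳ 0ᴳ))))) (hom 0ᴳ 0ᴳ)) ⟨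
    ψ 0ᴳ * y           ≈⟨ ψ0*y≈1 ⟩
    1#                 ∎
    where
      0ᴳ : Fin N
      0ᴳ = Fin.zero

  ψ≈ζ^ : ∀ x → ψ x ≈ ζ ^ toℕ x
  ψ≈ζ^ x = trans (reflexive (≡.cong ψ (≡.sym (FinP.fromℕ<-toℕ x (FinP.toℕ<n x))))) (ψ-fromℕ< (toℕ x) (FinP.toℕ<n x))
    where
      ψ-fromℕ< : ∀ j (j<N : j < N) → ψ (Fin.fromℕ< j<N) ≈ ζ ^ j
      ψ-fromℕ< zero    _    = ψ[0]≈1
      ψ-fromℕ< (suc j) 1+j<N = begin
        ψ (Fin.fromℕ< 1+j<N)     ≡⟨ ≡.cong ψ (FinP.toℕ-injective next) ⟩
        ψ (Fin.fromℕ< j<N ⊕ 1ᴳ)  ≈⟨ hom _ _ ⟩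
        ψ (Fin.fromℕ< j<N) * ζ   ≈⟨ *-congʳ (ψ-fromℕ< j j<N) ⟩
        ζ ^ j * ζ                ≈⟨ *-comm _ _ ⟩
        ζ ^ suc j                ∎
        where
          j<N : j < N
          j<N = ℕP.<-trans (ℕP.n<1+n j) 1+j<N
          next : toℕ (Fin.fromℕ< 1+j<N) ≡ toℕ (Fin.fromℕ< j<N ⊕ 1ᴳ)
          next = ≡.trans (FinP.toℕ-fromℕ< 1+j<N) (≡.sym (≡.trans (toℕ-⊕ (Fin.fromℕ< j<N) 1ᴳ)
                   (≡.trans (≡.cong (λ t → (t ℕ.+ 1) % N) (FinP.toℕ-fromℕ< j<N))
                   (≡.trans (≡.cong (_% N) (ℕP.+-comm j 1)) (ℕDM.m<n⇒m%n≡m 1+j<N)))))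

  ζ^N≈1 : ζ ^ N ≈ 1#
  ζ^N≈1 = begin
    ζ ^ N          ≈⟨ *-comm _ _ ⟩
    ζ ^ suc m * ζ  ≈⟨ *-congʳ (trans (ψ≈ζ^ last) (reflexive (≡.cong (ζ ^_) (FinP.toℕ-fromℕ (suc m))))) ⟨
    ψ last * ζ     ≈⟨ hom last 1ᴳ ⟨
    ψ (last ⊕ 1ᴳ)  ≡⟨ ≡.cong ψ (FinP.toℕ-injective wraps) ⟩
    ψ Fin.zero     ≈⟨ ψ[0]≈1 ⟩
    1#             ∎
    where
      last : Fin N
      last = Fin.fromℕ (suc m)
      wraps : toℕ (last ⊕ 1ᴳ) ≡ 0
      wraps = ≡.trans (toℕ-⊕ last 1ᴳ) (≡.trans (≡.cong (λ t → (t ℕ.+ 1) % N) (FinP.toℕ-fromℕ (suc m)))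
                (≡.trans (≡.cong (_% N) (ℕP.+-comm (suc m) 1)) (ℕDM.n%n≡0 N)))

  ζ-primitive : ∀ {o} → HasOrder R ψ o → IsPrimitiveRootOfUnity ζ o
  ζ-primitive (_ , ψᵒ≈1 , least) = ψᵒ≈1 1ᴳ , λ k 0<k k<o ζᵏ≈1 → ℕP.<⇒≱ k<o (least k 0<k (λ x → begin
    pow R (ψ x) k      ≈⟨ ^-cong k (ψ≈ζ^ x) ⟩
    (ζ ^ toℕ x) ^ k    ≈⟨ ^-* ζ k (toℕ x) ⟨
    ζ ^ (k ℕ.* toℕ x)  ≡⟨ ≡.cong (ζ ^_) (ℕP.*-comm k (toℕ x)) ⟩
    ζ ^ (toℕ x ℕ.* k)  ≈⟨ ^-* ζ (toℕ x) k ⟩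
    (ζ ^ k) ^ toℕ x    ≈⟨ ^-cong (toℕ x) ζᵏ≈1 ⟩
    1# ^ toℕ x         ≈⟨ 1^ (toℕ x) ⟩
    1#                 ∎))

module Proof {c ℓ} (R : CommutativeRing c ℓ) (ID : IsIntegralDomain R) (p′ n : ℕ)
             (ψ : Fin (Nₚ (suc (suc p′)) n) → CommutativeRing.Carrier R) (χ : IsCharacter R ψ)
             (o′ : ℕ) (ψ-order : HasOrder R ψ (suc o′)) where
  open CommutativeRing R hiding (zero)
  open IntegerImage R using (ιℕ; ι)
  open PowerSeries R
  open IntegerSeriesImage R
  open Characters R ψ χ
  open DistinctTupleSums R ψ using (F≈sumDistinct; sumDistinct-∏)
  private module ℤₛ = PowerSeries ℤP.+-*-commutativeRing

  p N o : ℕ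
  p = suc (suc p′)
  N = Nₚ p n
  o = suc o′

  η : Carrier
  η = ζ ^ p

  ζ-prim : IsPrimitiveRootOfUnity ζ o
  ζ-prim = ζ-primitive ψ-order

  D? : Decidable (InD p {N})
  D? x = ¬? (p ∣? toℕ x)

  Dprod : Seq
  Dprod = ∏[1- ψ u] filter D? (allFin N) · 1ₛ

  F≈Dprod : ∀ k → F R ψ (Xbar p N k) ≈ (- 1#) ^ k * ιℕ (k !) * Dprod k
  F≈Dprod k = trans (F≈sumDistinct k D?)
    (sumDistinct-∏ (filter D? (allFin N)) (does ∘ D?) (Unique.filter⁺ D? (Unique.allFin⁺ N)) enumerates k)
    where
      enumerates : ∀ x → does (D? x) ≡ true ⇔ x ∈ filter D? (allFin N)
      enumerates x = mk⇔ (λ eq → ∈-filter⁺ D? (∈-allFin x) (does-true (D? x) eq))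
                         (λ x∈ → dec-true (D? x) (proj₂ (∈-filter⁻ D? {xs = allFin N} x∈)))
        where
          does-true : ∀ {A : Set} (a? : Dec A) → does a? ≡ true → A
          does-true (yes a) _ = a

  F≈signedCoeff : ∀ k S → Dprod ≋ ιₛ S → F R ψ (Xbar p N k) ≈ fromℤ R (signedCoeff k S)
  F≈signedCoeff k S Dprod≋S = trans (F≈Dprod k) (trans (*-congˡ (Dprod≋S k)) (sym (fromℤ-signedCoeff k S)))

  -- Splitting Z_N into D_p and the multiples of p, whose ψ-values are the powers of η
  Dprod-relation : ∀ {e′} a b → IsPrimitiveRootOfUnity η (suc e′) → a ℕ.* suc e′ ≡ suc n → b ℕ.* o ≡ N →
                   [1-u^ suc e′ ]^ a · Dprod ≋ [1-u^ o ]^ b · 1ₛ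
  Dprod-relation {e′} a b η-prim ae≡1+n bo≡N = begin
    [1-u^ e ]^ a · Dprod
      ≈⟨ [1-u^]^-cong e a Dprod≋ ⟩
    [1-u^ e ]^ a · ∏[1- ζ ^_ u] nonMultiples · 1ₛ
      ≈⟨ ∏-[1-u^]^-comm (ζ ^_) nonMultiples e a 1ₛ ⟨
    ∏[1- ζ ^_ u] nonMultiples · [1-u^ e ]^ a · 1ₛ
      ≈⟨ ∏-cong nonMultiples (λ _ → refl) (RootsOfUnity.cyclotomic-power R ID η-prim a) ⟨
    ∏[1- ζ ^_ u] nonMultiples · ∏[1- η ^_ u] upTo (a ℕ.* e) · 1ₛ
      ≡⟨ ≡.cong (λ t → ∏[1- ζ ^_ u] nonMultiples · ∏[1- η ^_ u] upTo t · 1ₛ) ae≡1+n ⟩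
    ∏[1- ζ ^_ u] nonMultiples · ∏[1- η ^_ u] upTo (suc n) · 1ₛ
      ≈⟨ ∏-cong nonMultiples (λ _ → refl) multiples≋ ⟨
    ∏[1- ζ ^_ u] nonMultiples · ∏[1- ζ ^_ u] multiples · 1ₛ
      ≈⟨ ∏-comm (ζ ^_) nonMultiples (ζ ^_) multiples 1ₛ ⟩
    ∏[1- ζ ^_ u] multiples · ∏[1- ζ ^_ u] nonMultiples · 1ₛ
      ≈⟨ ∏-partition (p ∣?_) (ζ ^_) (upTo N) 1ₛ ⟨
    ∏[1- ζ ^_ u] upTo N · 1ₛ
      ≡⟨ ≡.cong (λ t → ∏[1- ζ ^_ u] upTo t · 1ₛ) bo≡N ⟨
    ∏[1- ζ ^_ u] upTo (b ℕ.* o) · 1ₛ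
      ≈⟨ RootsOfUnity.cyclotomic-power R ID ζ-prim b ⟩
    [1-u^ o ]^ b · 1ₛ
      ∎
    where
      open ≋-Reasoning
      e : ℕ
      e = suc e′
      multiples nonMultiples : List ℕ
      multiples    = filter (p ∣?_) (upTo N)
      nonMultiples = filter (∁? (p ∣?_)) (upTo N)
      Dprod≋ : Dprod ≋ ∏[1- ζ ^_ u] nonMultiples · 1ₛ
      Dprod≋ = ≋-trans (∏-cong (filter D? (allFin N)) ψ≈ζ^ ≋-refl) (≋-reflexive (≡.trans
        (≡.sym (∏-map (ζ ^_) toℕ (filter D? (allFin N)) 1ₛ))
        (≡.cong (λ xs → ∏[1- ζ ^_ u] xs · 1ₛ) (≡.trans (map-filter toℕ (∁? (p ∣?_)) (allFin N)) (≡.cong (filter (∁? (p ∣?_))) (map-toℕ-allFin N))))))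
      multiples≋ : ∏[1- ζ ^_ u] multiples · 1ₛ ≋ ∏[1- η ^_ u] upTo (suc n) · 1ₛ
      multiples≋ = ≋-trans (≋-reflexive (≡.trans
        (≡.cong (λ xs → ∏[1- ζ ^_ u] xs · 1ₛ) (filter-multiples (suc p′) (suc n)))
        (∏-map (ζ ^_) (ℕ._* p) (upTo (suc n)) 1ₛ)))
        (∏-cong (upTo (suc n)) (λ i → ^-* ζ i p) ≋-refl)

  η-primitive-coprime : Prime p → ¬ p ∣ o → IsPrimitiveRootOfUnity η o
  η-primitive-coprime p-prime p∤o = ηᵒ≈1 , minimal
    where
      ηᵒ≈1 : η ^ o ≈ 1#
      ηᵒ≈1 = trans (sym (^-* ζ o p)) (trans (reflexive (≡.cong (ζ ^_) (ℕP.*-comm o p)))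
               (trans (^-* ζ p o) (trans (^-cong p (proj₁ ζ-prim)) (1^ p))))
      minimal : ∀ j → 0 < j → j < o → ¬ η ^ j ≈ 1#
      minimal (suc j) _ j<o ηʲ≈1 = ℕP.<⇒≱ j<o (ℕDiv.∣⇒≤ (∣-cancelʳ-coprime (¬∣⇒coprime p-prime p∤o)
        (primitive-∣ ζ-prim (suc j ℕ.* p) (trans (^-* ζ (suc j) p) ηʲ≈1))))

  coprime-case : Prime p → ¬ p ∣ o → ∀ M → M ℕ.* (p ℕ.* o) ≡ (p ∸ 1) ℕ.* N → ∀ k →
                 F R ψ (Xbar p N k) ≈ fromℤ R (signedCoeff k (oneMinus o ^ₛ M))
  coprime-case p-prime p∤o M hM k = F≈signedCoeff k (oneMinus o ^ₛ M)
    (≋-trans ([1-u^]^-injective o (s≤s z≤n) a (begin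
      [1-u^ o ]^ a · Dprod                ≈⟨ Dprod-relation a (a ℕ.* p) (η-primitive-coprime p-prime p∤o) (≡.sym 1+n≡ao) apo≡N ⟩
      [1-u^ o ]^ (a ℕ.* p) · 1ₛ           ≡⟨ ≡.cong (λ t → [1-u^ o ]^ t · 1ₛ) ap≡a+M ⟩
      [1-u^ o ]^ (a ℕ.+ M) · 1ₛ           ≈⟨ [1-u^]^-+ o a M 1ₛ ⟩
      [1-u^ o ]^ a · [1-u^ o ]^ M · 1ₛ    ∎))
      (≋-sym (ιₛ-oneMinus^ o M)))
    where
      open ≋-Reasoning
      open ℕSolver.+-*-Solver using (solve; _:+_; _:*_; _:=_; con)
      o∣1+n : o ∣ suc n
      o∣1+n = ∣-cancelʳ-coprime (¬∣⇒coprime p-prime p∤o) (primitive-∣ ζ-prim N ζ^N≈1)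
      a : ℕ
      a = _∣_.quotient o∣1+n
      1+n≡ao : suc n ≡ a ℕ.* o
      1+n≡ao = _∣_.equality o∣1+n
      apo≡N : a ℕ.* p ℕ.* o ≡ N
      apo≡N = ≡.trans (solve 3 (λ a p o → a :* p :* o := a :* o :* p) ≡.refl a p o) (≡.cong (ℕ._* p) (≡.sym 1+n≡ao))
      M≡ : M ≡ suc p′ ℕ.* a
      M≡ = ℕP.*-cancelʳ-≡ M (suc p′ ℕ.* a) (p ℕ.* o) (≡.trans hM (≡.trans (≡.cong (λ t → suc p′ ℕ.* (t ℕ.* p)) 1+n≡ao)
             (solve 4 (λ q a o p → q :* (a :* o :* p) := q :* a :* (p :* o)) ≡.refl (suc p′) a o p)))
      ap≡a+M : a ℕ.* p ≡ a ℕ.+ M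
      ap≡a+M = ≡.trans (solve 2 (λ a q → a :* (con 1 :+ q) := a :+ q :* a) ≡.refl a (suc p′)) (≡.cong (a ℕ.+_) (≡.sym M≡))

  η-primitive-divisible : ∀ d → d ℕ.* p ≡ o → IsPrimitiveRootOfUnity η d
  η-primitive-divisible d dp≡o = ηᵈ≈1 , minimal
    where
      ηᵈ≈1 : η ^ d ≈ 1#
      ηᵈ≈1 = trans (sym (^-* ζ d p)) (trans (reflexive (≡.cong (ζ ^_) dp≡o)) (proj₁ ζ-prim))
      minimal : ∀ j → 0 < j → j < d → ¬ η ^ j ≈ 1#
      minimal j 0<j j<d ηʲ≈1 = proj₂ ζ-prim (j ℕ.* p) (ℕP.*-monoˡ-< p 0<j)
        (≡.subst (j ℕ.* p <_) dp≡o (ℕP.*-monoˡ-< p j<d)) (trans (^-* ζ j p) ηʲ≈1)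

  divisible-case : ∀ M d → M ℕ.* o ≡ N → d ℕ.* p ≡ o → ∀ Q → Q ⊛ (oneMinus d ^ₛ M) ℤₛ.≋ oneMinus o ^ₛ M → ∀ k →
                   F R ψ (Xbar p N k) ≈ fromℤ R (signedCoeff k Q)
  divisible-case M zero     _    ()   Q hQ k
  divisible-case M (suc d′) Mo≡N dp≡o Q hQ k = F≈signedCoeff k Q ([1-u^]^-injective d (s≤s z≤n) M (begin
    [1-u^ d ]^ M · Dprod        ≈⟨ Dprod-relation M M (η-primitive-divisible d dp≡o) Md≡1+n Mo≡N ⟩
    [1-u^ o ]^ M · 1ₛ           ≈⟨ ιₛ-oneMinus^ o M ⟨
    ιₛ (oneMinus o ^ₛ M)        ≈⟨ ιₛ-cong hQ ⟨
    ιₛ (Q ⊛ (oneMinus d ^ₛ M))  ≈⟨ ιₛ-cong (IntegerSeries.⊛-oneMinus^ Q d (s≤s z≤n) M) ⟩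
    ιₛ (ℤₛ.[1-u^ d ]^ M · Q)    ≈⟨ ιₛ-[1-u^]^ d M Q ⟩
    [1-u^ d ]^ M · ιₛ Q         ∎))
    where
      open ≋-Reasoning
      d : ℕ
      d = suc d′
      Md≡1+n : M ℕ.* d ≡ suc n
      Md≡1+n = ℕP.*-cancelʳ-≡ (M ℕ.* d) (suc n) p (≡.trans (ℕP.*-assoc M d p) (≡.trans (≡.cong (M ℕ.*_) dp≡o) Mo≡N))

-- ℕ multiplication is brought into scope only here, as the modules above use _*_ for the ring.
open import Data.Nat using (_*_)

lemma5p8 : ∀ {c ℓ : Level} (R : CommutativeRing c ℓ) → IsIntegralDomain R →
    ∀ (p n : ℕ) → Prime p → 3 ≤ p → 1 ≤ n →
    ∀ (ψ : Fin (Nₚ p n) → CommutativeRing.Carrier R) → IsCharacter R ψ →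
    ∀ (o : ℕ) → HasOrder R ψ o →
    ∀ (k : ℕ) → 1 ≤ k →
    -- (1) p ∤ o(ψ); M = (p-1) N_p / (p o(ψ))
    (¬ (p ∣ o) → ∀ (M : ℕ) → M * (p * o) ≡ (p ∸ 1) * Nₚ p n →
      CommutativeRing._≈_ R (F R ψ (Xbar p (Nₚ p n) k))
        (fromℤ R (signedCoeff k (oneMinus o ^ₛ M))))
    ×
    -- (2) p ∣ o(ψ); M = N_p / o(ψ), d = o(ψ)/p, Q = (1-u^o)^M / (1-u^d)^M
    (p ∣ o → ∀ (M d : ℕ) → M * o ≡ Nₚ p n → d * p ≡ o →
      ∀ (Q : Series) → (∀ j → (Q ⊛ (oneMinus d ^ₛ M)) j ≡ (oneMinus o ^ₛ M) j) →
      CommutativeRing._≈_ R (F R ψ (Xbar p (Nₚ p n) k))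
        (fromℤ R (signedCoeff k Q)))
lemma5p8 R ID p n p-prime 3≤p _ ψ χ zero (() , _) k _
lemma5p8 R ID (suc (suc (suc p″))) n p-prime (s≤s (s≤s (s≤s _))) _ ψ χ (suc o′) ψ-order k _ =
  (λ p∤o M hM → coprime-case p-prime p∤o M hM k) ,
  (λ _ M d Mo≡N dp≡o Q hQ → divisible-case M d Mo≡N dp≡o Q hQ k)
  where open Proof R ID (suc p″) n ψ χ o′ ψ-order
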